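{- Let $G$ be an $\{\mathrm{ISK4},\mathrm{wheel}\}$-free trigraph that contains a strong $K_{3,3}$ as an induced subtrigraph. Then either $G$ is a thick complete bipartite trigraph, or $G$ admits a clique-cutset.
   Context: A trigraph $G$ is a finite set $V(G)$ with a function $\theta_G$ from 2-element subsets to $\{ -1,0,1\}$; $uv$ is strongly adjacent if $\theta_G(uv)=1$, semi-adjacent if $0$, strongly anti-adjacent if $-1$, adjacent if $\ge0$. A realization is a graph obtained by turning each semi-adjacent pair into an edge or non-edge; the full realization makes them all edges. $G$ is $\{\mathrm{ISK4},\mathrm{wheel}\}$-free if no realization contains an induced subgraph isomorphic to a subdivision of $K_4$ or to a wheel (a chordless cycle plus a vertex with at least three neighbors on it). Induced subtrigraphs restrict $\theta_G$; $G\setminus X=G[V(G)\setminus X]$; connected means the full realization is connected. A strong $K_{3,3}$ is a trigraph whose full realization is $K_{3,3}$ and which has no semi-adjacent pairs. A complete bipartite trigraph is one whose vertex set partitions into two strongly stable sets (pairwise strongly anti-adjacent) strongly complete to each other; it is thick if both sets have at least three vertices. A cutset is a (possibly empty) set $C$ with $G\setminus C$ disconnected; a clique-cutset is a cutset whose vertices are pairwise strongly adjacent. -}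

module Defs where

open import Data.Nat using (ℕ; zero; suc; _≤_; _%_)
open import Data.Fin using (Fin; zero; suc; toℕ; _≟_)
open import Data.Fin.Subset using (Subset; _∈_; _∉_; ∁; ∣_∣)
open import Data.Bool using (Bool; true; false; not; _∧_; _∨_)
open import Data.Product using (Σ; _×_; ∃; ∃-syntax; _,_)
open import Data.Sum using (_⊎_)
open import Function.Definitions using (Injective)
open import Function.Bundles using (_⇔_)
open import Relation.Nullary using (¬_; does)
open import Relation.Binary.PropositionalEquality using (_≡_; _≢_)

-- The three values of θ: strong = 1, semi = 0, anti = -1.
data Adjacency : Set where
  strong semi anti : Adjacency

-- θ is given on ordered pairs but required symmetric; its value on the
-- diagonal (u , u) is irrelevant and never used.
record Trigraph (n : ℕ) : Set where
  field
    θ     : Fin n → Fin n → Adjacency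
    θ-sym : ∀ u v → θ u v ≡ θ v u
open Trigraph public

Adjacent : ∀ {n} → Trigraph n → Fin n → Fin n → Set
Adjacent G u v = θ G u v ≢ anti

-- Graphs (adjacency given by a Bool-valued function; diagonal ignored)

Graph : ℕ → Set
Graph m = Fin m → Fin m → Bool

-- A realization of G: a graph on V(G) that agrees with θ on strong
-- adjacencies and strong anti-adjacencies (semi-adjacent pairs are free).
record Realization {n : ℕ} (G : Trigraph n) : Set where
  field
    edge      : Graph n
    edge-sym  : ∀ u v → edge u v ≡ edge v u
    edge-strong : ∀ u v → u ≢ v → θ G u v ≡ strong → edge u v ≡ true
    edge-anti   : ∀ u v → u ≢ v → θ G u v ≡ anti → edge u v ≡ false
open Realization public

ContainsInduced : ∀ {n m} → Graph n → Graph m → Set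
ContainsInduced {n} {m} H S =
  Σ (Fin m → Fin n) λ f → Injective _≡_ _≡_ f ×
    (∀ i j → i ≢ j → H (f i) (f j) ≡ S i j)

K4 : Graph 4
K4 i j = not (does (i ≟ j))

-- subdivide the edge uv: new vertex zero, old vertices shifted by suc
subdivide : ∀ {m} → Graph m → Fin m → Fin m → Graph (suc m)
subdivide A u v zero    zero    = false
subdivide A u v zero    (suc j) = does (j ≟ u) ∨ does (j ≟ v)
subdivide A u v (suc i) zero    = does (i ≟ u) ∨ does (i ≟ v)
subdivide A u v (suc i) (suc j) =
  A i j ∧ not ((does (i ≟ u) ∧ does (j ≟ v)) ∨ (does (i ≟ v) ∧ does (j ≟ u)))

data IsSubdivisionOfK4 : ∀ {m} → Graph m → Set where
  k4  : IsSubdivisionOfK4 K4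
  sub : ∀ {m} {A : Graph m} {u v : Fin m} → IsSubdivisionOfK4 A →
        u ≢ v → A u v ≡ true → IsSubdivisionOfK4 (subdivide A u v)

ContainsISK4 : ∀ {n} → Graph n → Set
ContainsISK4 H = ∃[ m ] Σ (Graph m) λ S → IsSubdivisionOfK4 S × ContainsInduced H S

-- consecutive indices on a cycle of length k = 3 + k'
CycleAdj : ∀ k' → Fin (suc (suc (suc k'))) → Fin (suc (suc (suc k'))) → Set
CycleAdj k' i j =
  toℕ j ≡ suc (toℕ i) % suc (suc (suc k')) ⊎ toℕ i ≡ suc (toℕ j) % suc (suc (suc k'))

ContainsWheel : ∀ {n} → Graph n → Set
ContainsWheel {n} H =
  ∃[ k' ] Σ (Fin (suc (suc (suc k'))) → Fin n) λ c → Σ (Fin n) λ x →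
    Injective _≡_ _≡_ c ×
    (∀ i → c i ≢ x) ×
    (∀ i j → i ≢ j → (H (c i) (c j) ≡ true ⇔ CycleAdj k' i j)) ×
    (∃[ i ] ∃[ j ] ∃[ l ] (i ≢ j × i ≢ l × j ≢ l ×
       H x (c i) ≡ true × H x (c j) ≡ true × H x (c l) ≡ true))

ISK4WheelFree : ∀ {n} → Trigraph n → Set
ISK4WheelFree G = ∀ (R : Realization G) → ¬ ContainsISK4 (edge R) × ¬ ContainsWheel (edge R)

ContainsStrongK33 : ∀ {n} → Trigraph n → Set
ContainsStrongK33 {n} G =
  Σ (Fin 3 → Fin n) λ a → Σ (Fin 3 → Fin n) λ b →
    Injective _≡_ _≡_ a × Injective _≡_ _≡_ b ×
    (∀ i j → a i ≢ b j) ×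
    (∀ i j → θ G (a i) (b j) ≡ strong) ×
    (∀ i j → i ≢ j → θ G (a i) (a j) ≡ anti) ×
    (∀ i j → i ≢ j → θ G (b i) (b j) ≡ anti)

StronglyStable : ∀ {n} → Trigraph n → Subset n → Set
StronglyStable G S = ∀ u v → u ∈ S → v ∈ S → u ≢ v → θ G u v ≡ anti

IsThickCompleteBipartite : ∀ {n} → Trigraph n → Set
IsThickCompleteBipartite {n} G = Σ (Subset n) λ A →
  StronglyStable G A × StronglyStable G (∁ A) ×
  (∀ u v → u ∈ A → v ∉ A → θ G u v ≡ strong) ×
  3 ≤ ∣ A ∣ × 3 ≤ ∣ ∁ A ∣

-- Connectivity of G[S] (via the full realization: adjacent pairs)

data Reach {n} (G : Trigraph n) (S : Subset n) : Fin n → Fin n → Set where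
  here : ∀ {u} → u ∈ S → Reach G S u u
  step : ∀ {u w v} → u ∈ S → Adjacent G u w → Reach G S w v → Reach G S u v

-- G[S] connected (the empty trigraph counts as connected)
ConnectedOn : ∀ {n} → Trigraph n → Subset n → Set
ConnectedOn G S = ∀ u v → u ∈ S → v ∈ S → Reach G S u v

IsCutset : ∀ {n} → Trigraph n → Subset n → Set
IsCutset G C = ¬ ConnectedOn G (∁ C)

IsCliqueCutset : ∀ {n} → Trigraph n → Subset n → Set
IsCliqueCutset G C = IsCutset G C × (∀ u v → u ∈ C → v ∈ C → u ≢ v → θ G u v ≡ strong)

HasCliqueCutset : ∀ {n} → Trigraph n → Set
HasCliqueCutset {n} G = Σ (Subset n) λ C → IsCliqueCutset G C

-- A frame (X , Y) is a pair of disjoint strongly stable sets, strongly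
-- complete to each other, each with three named distinct vertices; the
-- strong K3,3 is a frame.  While some vertex v off the frame is adjacent to
-- all of one side and strongly anti-adjacent to the other, v is in fact
-- strongly complete to that side (in the realization where a semi-edge to
-- it is a non-edge there would be an ISK4), so v joins the other side.  When
-- this stops, either the frame covers G, which is then thick complete
-- bipartite, or some v₀ lies off the frame.  The attachment lemma says that,
-- in the full realization, no walk outside the frame has two distinct
-- neighbours on one side: a minimal such walk is an induced path that
-- closes a wheel or an ISK4 with the frame.  Hence the frame vertices with a
-- neighbour in the component of v₀ in G \ (X ∪ Y) meet each side at most
-- once, form a clique, and separate v₀ from x₁ or x₂.
module Submission where

open import Defs
open import Data.Nat using (ℕ; zero; suc; _+_; _≤_; _<_; z≤n; s≤s; _%_; _<?_; _≤?_)
open import Data.Nat.Properties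
  using (suc-injective; ≤-<-trans; <-≤-trans; <-cmp; m≤n⇒m<n∨m≡n; <-irrefl; ≤-refl; ≤-trans; <⇒≤;
         n<1+n; ≤-pred; m≤n⇒m≤1+n; ≮⇒≥; m≤m+n; m<m+n; +-monoˡ-<; +-monoˡ-≤; +-suc; +-identityʳ; m≤n+m;
         m≤n⇒∃[o]m+o≡n; ≰⇒>; ≤-antisym; anyUpTo?)
open import Data.Nat.DivMod using (m<n⇒m%n≡m; n%n≡0)
open import Data.Nat.Tactic.RingSolver using (solve-∀)
open import Data.Fin using (Fin; zero; suc; toℕ; fromℕ<; _≟_)
open import Data.Fin.Properties using (toℕ<n; toℕ-injective; toℕ-fromℕ<; any?; all?)
open import Data.Fin.Subset using (Subset; _∈_; _∉_; ∁; ∣_∣; _-_; _⊆_; ⁅_⁆; _∪_)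
open import Data.Fin.Subset.Properties
  using (_∈?_; x∈p∪q⁻; x∈p∪q⁺; x∈⁅x⁆; x∈⁅y⁆⇒x≡y; ∣p∣≤n; x∉p⇒x∈∁p; x∈∁p⇒x∉p; x∈p⇒∣p-x∣<∣p∣;
         x∈p∧x≢y⇒x∈p-y; p─q⊆p; p⊂q⇒∣p∣<∣q∣; p⊆p∪q; q⊆p∪q)
open import Data.Vec using (_∷_; there; tabulate)
open import Data.Vec.Properties using (lookup∘tabulate; []=⇒lookup; lookup⇒[]=)
open import Data.Bool using (Bool; true; false; not; _∧_; _∨_)
open import Data.Bool.Properties
  using (∨-zeroʳ; ∧-identityʳ; ∧-zeroʳ; ∨-comm; ∧-comm; ¬-not) renaming (_≟_ to _≟-bool_)
open import Data.Product using (Σ; ∃; _×_; _,_; proj₁; proj₂)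
open import Data.Sum using (_⊎_; inj₁; inj₂; swap) renaming (map to ⊎-map)
open import Data.Empty using (⊥; ⊥-elim)
open import Function using (_∘_; case_of_)
open import Function.Bundles using (_⇔_; mk⇔)
import Function.Properties.Equivalence as ⇔
open import Function.Definitions using (Injective)
open import Relation.Nullary using (¬_; Dec; yes; no; ¬?; does)
open import Relation.Nullary.Decidable using (dec-true; dec-false; _×-dec_; _⊎-dec_; _→-dec_)
open import Relation.Binary using (tri<; tri≈; tri>)
open import Relation.Binary.PropositionalEquality

-- It is the test
-- `subdivide` uses to delete the subdivided edge uv, and it also describes
-- the single pair whose adjacency changes when a semi-edge is toggled.
isPair : ∀ {m} → Fin m → Fin m → Fin m → Fin m → Bool
isPair u v i j = (does (i ≟ u) ∧ does (j ≟ v)) ∨ (does (i ≟ v) ∧ does (j ≟ u))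

isPair-sym : ∀ {m} (u v i j : Fin m) → isPair u v i j ≡ isPair u v j i
isPair-sym u v i j =
  trans (∨-comm (does (i ≟ u) ∧ does (j ≟ v)) (does (i ≟ v) ∧ does (j ≟ u)))
        (cong₂ _∨_ (∧-comm (does (i ≟ v)) (does (j ≟ u))) (∧-comm (does (i ≟ u)) (does (j ≟ v))))

isPair-uv : ∀ {m} (u v : Fin m) → isPair u v u v ≡ true
isPair-uv u v rewrite dec-true (u ≟ u) refl | dec-true (v ≟ v) refl = refl

isPair-vu : ∀ {m} (u v : Fin m) → isPair u v v u ≡ true
isPair-vu u v = trans (isPair-sym u v v u) (isPair-uv u v)

isPair-other : ∀ {m} {u v : Fin m} (i j : Fin m) →
  ¬ (i ≡ u × j ≡ v) → ¬ (i ≡ v × j ≡ u) → isPair u v i j ≡ false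
isPair-other {u = u} {v} i j not-uv not-vu with i ≟ u | j ≟ v | i ≟ v | j ≟ u
... | yes iu | yes jv | _      | _      = ⊥-elim (not-uv (iu , jv))
... | _      | _      | yes iv | yes ju = ⊥-elim (not-vu (iv , ju))
... | no _   | _      | no _   | _      = refl
... | no _   | _      | yes _  | no _   = refl
... | yes _  | no _   | no _   | _      = refl
... | yes _  | no _   | yes _  | no _   = refl

K4-sym : ∀ i j → K4 i j ≡ K4 j i
K4-sym i j with i ≟ j | j ≟ i
... | yes _  | yes _  = refl
... | no _   | no _   = refl
... | yes ij | no ji  = ⊥-elim (ji (sym ij))
... | no ij  | yes ji = ⊥-elim (ij (sym ji))

subdivision-sym : ∀ {m} {A : Graph m} → IsSubdivisionOfK4 A → ∀ i j → A i j ≡ A j i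
subdivision-sym k4 = K4-sym
subdivision-sym (sub s _ _) zero    zero    = refl
subdivision-sym (sub s _ _) zero    (suc j) = refl
subdivision-sym (sub s _ _) (suc i) zero    = refl
subdivision-sym (sub {u = u} {v} s _ _) (suc i) (suc j) =
  cong₂ (λ a p → a ∧ not p) (subdivision-sym s i j) (isPair-sym u v i j)

module InducedStructures {n : ℕ} (H : Graph n) (H-sym : ∀ u v → H u v ≡ H v u) where

  extend : ∀ {m} → Fin n → (Fin m → Fin n) → Fin (suc m) → Fin n
  extend x g zero    = x
  extend x g (suc i) = g i

  extend-injective : ∀ {m} {x} {g : Fin m → Fin n} →
    Injective _≡_ _≡_ g → (∀ j → x ≢ g j) → Injective _≡_ _≡_ (extend x g)
  extend-injective g-inj new {zero}  {zero}  _ = refl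
  extend-injective g-inj new {zero}  {suc j} e = ⊥-elim (new j e)
  extend-injective g-inj new {suc i} {zero}  e = ⊥-elim (new i (sym e))
  extend-injective g-inj new {suc i} {suc j} e = cong suc (g-inj e)

  InducedExcept : ∀ {m} → Graph m → Fin m → Fin m → (Fin m → Fin n) → Set
  InducedExcept A u v g =
    ∀ i j → i ≢ j → ¬ (i ≡ u × j ≡ v) → ¬ (i ≡ v × j ≡ u) → H (g i) (g j) ≡ A i j

  DetourEnds : ∀ {m} → (Fin m → Fin n) → Fin m → Fin m → ℕ → (ℕ → Fin n) → Set
  DetourEnds g u v zero    q = H (g u) (g v) ≡ true
  DetourEnds g u v (suc L) q = H (g u) (g v) ≡ false × H (q 0) (g u) ≡ true × H (q L) (g v) ≡ true

  record Detour {m} (g : Fin m → Fin n) (u v : Fin m) (L : ℕ) (q : ℕ → Fin n) : Set where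
    field
      injective   : ∀ i j → i < L → j < L → q i ≡ q j → i ≡ j
      avoids      : ∀ i j → i < L → q i ≢ g j
      edges       : ∀ i → suc i < L → H (q i) (q (suc i)) ≡ true
      chordless   : ∀ i j → i < L → j < L → i ≢ j → H (q i) (q j) ≡ true → j ≡ suc i ⊎ i ≡ suc j
      attachments : ∀ i j → i < L → H (q i) (g j) ≡ true → (i ≡ 0 × j ≡ u) ⊎ (suc i ≡ L × j ≡ v)
      ends        : DetourEnds g u v L q

  -- Absorbing the first vertex of a detour into the embedding: q 0 becomes the
  -- subdividing vertex (index zero) of the edge uv, and the rest of the path
  -- is a detour between it and v.
  shift-detour : ∀ {m} {g : Fin m → Fin n} {u v L q} → u ≢ v →
    Detour g u v (suc L) q → Detour (extend (q 0) g) zero (suc v) L (q ∘ suc)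
  shift-detour {g = g} {u} {v} {L} {q} u≢v d = record
    { injective   = λ i j i<L j<L e → suc-injective (injective (suc i) (suc j) (s≤s i<L) (s≤s j<L) e)
    ; avoids      = avoids′
    ; edges       = λ i i<L → edges (suc i) (s≤s i<L)
    ; chordless   = λ i j i<L j<L i≢j h → ⊎-map suc-injective suc-injective
                      (chordless (suc i) (suc j) (s≤s i<L) (s≤s j<L) (i≢j ∘ suc-injective) h)
    ; attachments = attachments′
    ; ends        = ends′ L ends edges (attachments 0 v (s≤s z≤n))
    }
    where
    open Detour d
    avoids′ : ∀ i j → i < L → q (suc i) ≢ extend (q 0) g j
    avoids′ i zero    i<L e with injective (suc i) 0 (s≤s i<L) (s≤s z≤n) e
    ... | ()
    avoids′ i (suc j) i<L = avoids (suc i) j (s≤s i<L)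
    attachments′ : ∀ i j → i < L → H (q (suc i)) (extend (q 0) g j) ≡ true →
                   (i ≡ 0 × j ≡ zero) ⊎ (suc i ≡ L × j ≡ suc v)
    attachments′ i zero i<L h with chordless (suc i) 0 (s≤s i<L) (s≤s z≤n) (λ ()) h
    ... | inj₂ e = inj₁ (suc-injective e , refl)
    attachments′ i (suc j) i<L h with attachments (suc i) j (s≤s i<L) h
    ... | inj₂ (e , j≡v) = inj₂ (suc-injective e , cong suc j≡v)
    -- q 0 is not adjacent to g v unless the detour has length one
    ends′ : ∀ L′ → DetourEnds g u v (suc L′) q → (∀ i → suc i < suc L′ → H (q i) (q (suc i)) ≡ true) →
            (H (q 0) (g v) ≡ true → (0 ≡ 0 × v ≡ u) ⊎ (1 ≡ suc L′ × v ≡ v)) →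
            DetourEnds (extend (q 0) g) zero (suc v) L′ (q ∘ suc)
    ends′ zero     (_ , _ , qLv) _ _          = qLv
    ends′ (suc L′) (_ , _ , qLv) path first-v =
      ¬-not (λ h → case first-v h of λ { (inj₁ (_ , v≡u)) → u≢v (sym v≡u) ; (inj₂ (() , _)) })
      , trans (H-sym _ _) (path 0 (s≤s (s≤s z≤n)))
      , qLv

  subdivide-inducedExcept : ∀ {m} {A : Graph m} {u v g L q} →
    InducedExcept A u v g → Detour g u v (suc L) q →
    InducedExcept (subdivide A u v) zero (suc v) (extend (q 0) g)
  subdivide-inducedExcept {A = A} {u} {v} {g} {L} {q} induced d = on-new-graph
    where
    open Detour d
    g-u≁g-v : H (g u) (g v) ≡ false
    g-u≁g-v = proj₁ ends
    first-to-old : ∀ j → j ≢ v → H (q 0) (g j) ≡ (does (j ≟ u) ∨ does (j ≟ v))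
    first-to-old j j≢v rewrite dec-false (j ≟ v) j≢v with j ≟ u
    ... | yes refl = proj₁ (proj₂ ends)
    ... | no j≢u = ¬-not (λ h → case attachments 0 j (s≤s z≤n) h of λ
                     { (inj₁ (_ , j≡u)) → j≢u j≡u ; (inj₂ (_ , j≡v)) → j≢v j≡v })
    old-to-old : ∀ i j → i ≢ j → H (g i) (g j) ≡ A i j ∧ not (isPair u v i j)
    old-to-old i j i≢j with (i ≟ u ×-dec j ≟ v) | (i ≟ v ×-dec j ≟ u)
    ... | yes (refl , refl) | _ =
      trans g-u≁g-v (sym (trans (cong (λ p → A u v ∧ not p) (isPair-uv u v)) (∧-zeroʳ _)))
    ... | no _ | yes (refl , refl) =
      trans (H-sym _ _) (trans g-u≁g-v (sym (trans (cong (λ p → A v u ∧ not p) (isPair-vu u v)) (∧-zeroʳ _))))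
    ... | no ¬uv | no ¬vu =
      trans (induced i j i≢j ¬uv ¬vu) (sym (trans (cong (λ p → A i j ∧ not p) (isPair-other i j ¬uv ¬vu)) (∧-identityʳ _)))
    on-new-graph : InducedExcept (subdivide A u v) zero (suc v) (extend (q 0) g)
    on-new-graph zero    zero    i≢j _ _ = ⊥-elim (i≢j refl)
    on-new-graph zero    (suc j) _ ¬new _ = first-to-old j (λ j≡v → ¬new (refl , cong suc j≡v))
    on-new-graph (suc i) zero    _ _ ¬new = trans (H-sym _ _) (first-to-old i (λ i≡v → ¬new (cong suc i≡v , refl)))
    on-new-graph (suc i) (suc j) i≢j _ _ = old-to-old i j (i≢j ∘ cong suc)

  -- An embedding of a subdivision A of K4, induced except on an edge uv of A
  -- that is replaced by a detour, yields an ISK4: subdivide uv once per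
  -- vertex of the detour.
  isk4-from-detour : ∀ {m} {A : Graph m} → IsSubdivisionOfK4 A → ∀ {u v} → u ≢ v → A u v ≡ true →
    ∀ {g} → Injective _≡_ _≡_ g → InducedExcept A u v g → ∀ {L q} → Detour g u v L q → ContainsISK4 H
  isk4-from-detour {m} {A} A-sub {u} {v} u≢v uv-edge {g} g-inj induced {zero} d =
    m , A , A-sub , g , g-inj , induced-everywhere
    where
    induced-everywhere : ∀ i j → i ≢ j → H (g i) (g j) ≡ A i j
    induced-everywhere i j i≢j with (i ≟ u ×-dec j ≟ v) | (i ≟ v ×-dec j ≟ u)
    ... | yes (refl , refl) | _ = trans (Detour.ends d) (sym uv-edge)
    ... | no _ | yes (refl , refl) =
      trans (H-sym _ _) (trans (Detour.ends d) (trans (sym uv-edge) (subdivision-sym A-sub u v)))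
    ... | no ¬uv | no ¬vu = induced i j i≢j ¬uv ¬vu
  isk4-from-detour A-sub {u} {v} u≢v uv-edge g-inj induced {suc L} {q} d =
    isk4-from-detour (sub A-sub u≢v uv-edge) (λ ()) new-edge
      (extend-injective g-inj (λ j → Detour.avoids d 0 j (s≤s z≤n)))
      (subdivide-inducedExcept induced d) (shift-detour u≢v d)
    where
    new-edge : does (v ≟ u) ∨ does (v ≟ v) ≡ true
    new-edge = trans (cong (does (v ≟ u) ∨_) (dec-true (v ≟ v) refl)) (∨-zeroʳ _)

  cycleAdj⇔ : ∀ k′ i j → i < j → j < 3 + k′ →
    (j ≡ suc i % (3 + k′) ⊎ i ≡ suc j % (3 + k′)) ⇔ (j ≡ suc i ⊎ (i ≡ 0 × j ≡ suc (suc k′)))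
  cycleAdj⇔ k′ i j i<j j<N = mk⇔ to from
    where
    si%N : suc i % (3 + k′) ≡ suc i
    si%N = m<n⇒m%n≡m (≤-<-trans i<j j<N)
    to : (j ≡ suc i % (3 + k′) ⊎ i ≡ suc j % (3 + k′)) → (j ≡ suc i ⊎ (i ≡ 0 × j ≡ suc (suc k′)))
    to (inj₁ e) = inj₁ (trans e si%N)
    to (inj₂ e) with m≤n⇒m<n∨m≡n j<N
    ... | inj₁ sj<N = ⊥-elim (<-irrefl refl (≤-trans (s≤s (subst (_≤ j) (trans e (m<n⇒m%n≡m sj<N)) (<⇒≤ i<j))) ≤-refl))
    ... | inj₂ sj≡N = inj₂ (trans e (trans (cong (_% (3 + k′)) sj≡N) (n%n≡0 (3 + k′))) , suc-injective sj≡N)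
    from : (j ≡ suc i ⊎ (i ≡ 0 × j ≡ suc (suc k′))) → (j ≡ suc i % (3 + k′) ⊎ i ≡ suc j % (3 + k′))
    from (inj₁ e) = inj₁ (trans e (sym si%N))
    from (inj₂ (refl , refl)) = inj₂ (sym (n%n≡0 (3 + k′)))

  wheel-from-hole : ∀ k′ (f : ℕ → Fin n) (x : Fin n) →
    (∀ i j → i < 3 + k′ → j < 3 + k′ → f i ≡ f j → i ≡ j) →
    (∀ i → i < 3 + k′ → f i ≢ x) →
    (∀ i j → i < j → j < 3 + k′ → (H (f i) (f j) ≡ true ⇔ (j ≡ suc i ⊎ (i ≡ 0 × j ≡ suc (suc k′))))) →
    ∀ i₁ i₂ i₃ → i₁ < 3 + k′ → i₂ < 3 + k′ → i₃ < 3 + k′ → i₁ ≢ i₂ → i₁ ≢ i₃ → i₂ ≢ i₃ →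
    H x (f i₁) ≡ true → H x (f i₂) ≡ true → H x (f i₃) ≡ true → ContainsWheel H
  wheel-from-hole k′ f x f-inj f≢x f-adj i₁ i₂ i₃ l₁ l₂ l₃ d₁₂ d₁₃ d₂₃ h₁ h₂ h₃ =
    k′ , c , x , c-inj , (λ i → f≢x (toℕ i) (toℕ<n i)) , c-adj ,
    fromℕ< l₁ , fromℕ< l₂ , fromℕ< l₃ , distinct l₁ l₂ d₁₂ , distinct l₁ l₃ d₁₃ , distinct l₂ l₃ d₂₃ ,
    spoke l₁ h₁ , spoke l₂ h₂ , spoke l₃ h₃
    where
    N = 3 + k′
    c : Fin N → Fin n
    c i = f (toℕ i)
    c-inj : Injective _≡_ _≡_ c
    c-inj {a} {b} e = toℕ-injective (f-inj _ _ (toℕ<n a) (toℕ<n b) e)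
    distinct : ∀ {a b} (la : a < N) (lb : b < N) → a ≢ b → fromℕ< la ≢ fromℕ< lb
    distinct la lb a≢b e = a≢b (trans (sym (toℕ-fromℕ< la)) (trans (cong toℕ e) (toℕ-fromℕ< lb)))
    spoke : ∀ {a} (la : a < N) → H x (f a) ≡ true → H x (c (fromℕ< la)) ≡ true
    spoke la h = subst (λ z → H x (f z) ≡ true) (sym (toℕ-fromℕ< la)) h
    c-adj : ∀ i j → i ≢ j → (H (c i) (c j) ≡ true ⇔ CycleAdj k′ i j)
    c-adj i j i≢j with <-cmp (toℕ i) (toℕ j)
    ... | tri< lt _ _ = ⇔.trans (f-adj _ _ lt (toℕ<n j)) (⇔.sym (cycleAdj⇔ k′ _ _ lt (toℕ<n j)))
    ... | tri≈ _ e _ = ⊥-elim (i≢j (toℕ-injective e))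
    ... | tri> _ _ gt =
      ⇔.trans (subst (λ b → (H (c i) (c j) ≡ true) ⇔ (b ≡ true)) (H-sym _ _) ⇔.refl)
        (⇔.trans (f-adj _ _ gt (toℕ<n i)) (⇔.trans (⇔.sym (cycleAdj⇔ k′ _ _ gt (toℕ<n i))) (mk⇔ swap swap)))

  record InducedPath (w : ℕ → Fin n) (K : ℕ) : Set where
    field
      injective : ∀ i j → i ≤ K → j ≤ K → w i ≡ w j → i ≡ j
      chordless : ∀ i j → i < j → j ≤ K → H (w i) (w j) ≡ true → j ≡ suc i
      edges     : ∀ i → i < K → H (w i) (w (suc i)) ≡ true

  -- A vertex b whose neighbours on an induced path are exactly its two ends
  -- closes a hole; a further vertex h seeing both ends and an interior vertex
  -- of the path is the centre of a wheel.
  wheel-from-path : ∀ w k → let K = suc (suc k) in InducedPath w K → (b h : Fin n) →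
    (∀ m → m ≤ K → b ≢ w m) →
    (∀ m → m ≤ K → H b (w m) ≡ true → m ≡ 0 ⊎ m ≡ K) →
    H b (w 0) ≡ true → H b (w K) ≡ true →
    h ≢ b → (∀ m → m ≤ K → h ≢ w m) →
    H h (w 0) ≡ true → H h (w K) ≡ true → ∀ i → 0 < i → i < K → H h (w i) ≡ true → ContainsWheel H
  wheel-from-path w k p b h b∉w b-ends b-w₀ b-wK h≢b h∉w h-w₀ h-wK i 0<i i<K h-wi =
    wheel-from-hole (suc k) hole h hole-inj hole-avoids-h hole-adj 1 (suc i) (suc K)
      (s≤s (s≤s z≤n)) (s≤s (m≤n⇒m≤1+n i<K)) (s≤s (n<1+n _))
      (λ e → <-irrefl (suc-injective e) 0<i) (λ e → case suc-injective e of λ ()) (λ e → <-irrefl (suc-injective e) i<K)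
      h-w₀ h-wi h-wK
    where
    open InducedPath p
    K = suc (suc k)
    N = 3 + suc k
    hole : ℕ → Fin n
    hole zero    = b
    hole (suc m) = w m
    hole-inj : ∀ i j → i < N → j < N → hole i ≡ hole j → i ≡ j
    hole-inj zero    zero    _  _  _ = refl
    hole-inj zero    (suc j) _  lj e = ⊥-elim (b∉w j (≤-pred (≤-pred lj)) e)
    hole-inj (suc i) zero    li _  e = ⊥-elim (b∉w i (≤-pred (≤-pred li)) (sym e))
    hole-inj (suc i) (suc j) li lj e = cong suc (injective i j (≤-pred (≤-pred li)) (≤-pred (≤-pred lj)) e)
    hole-avoids-h : ∀ i → i < N → hole i ≢ h
    hole-avoids-h zero    _  e = h≢b (sym e)
    hole-avoids-h (suc m) lm e = h∉w m (≤-pred (≤-pred lm)) (sym e)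
    hole-adj : ∀ i j → i < j → j < N → (H (hole i) (hole j) ≡ true ⇔ (j ≡ suc i ⊎ (i ≡ 0 × j ≡ suc K)))
    hole-adj zero zero () _
    hole-adj zero (suc m) _ lm = mk⇔ to from
      where
      to : H b (w m) ≡ true → (suc m ≡ 1 ⊎ (0 ≡ 0 × suc m ≡ suc K))
      to hb with b-ends m (≤-pred (≤-pred lm)) hb
      ... | inj₁ e = inj₁ (cong suc e)
      ... | inj₂ e = inj₂ (refl , cong suc e)
      from : (suc m ≡ 1 ⊎ (0 ≡ 0 × suc m ≡ suc K)) → H b (w m) ≡ true
      from (inj₁ e)       = subst (λ z → H b (w z) ≡ true) (sym (suc-injective e)) b-w₀
      from (inj₂ (_ , e)) = subst (λ z → H b (w z) ≡ true) (sym (suc-injective e)) b-wK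
    hole-adj (suc i) zero () _
    hole-adj (suc i) (suc j) lt lj = mk⇔ to from
      where
      to : H (w i) (w j) ≡ true → (suc j ≡ suc (suc i) ⊎ (suc i ≡ 0 × suc j ≡ suc K))
      to hw = inj₁ (cong suc (chordless i j (≤-pred lt) (≤-pred (≤-pred lj)) hw))
      from : (suc j ≡ suc (suc i) ⊎ (suc i ≡ 0 × suc j ≡ suc K)) → H (w i) (w j) ≡ true
      from (inj₁ e) = subst (λ z → H (w i) (w z) ≡ true) (sym (suc-injective e))
                        (edges i (subst (_≤ K) (suc-injective e) (≤-pred (≤-pred lj))))

  pattern at-c  = zero
  pattern at-w₀ = suc zero
  pattern at-wK = suc (suc zero)
  pattern at-b₁ = suc (suc (suc zero))
  pattern at-b₂ = suc (suc (suc (suc zero)))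

  nowhere : Fin 0 → Fin n
  nowhere ()

  nowhere-injective : Injective _≡_ _≡_ nowhere
  nowhere-injective {()}

  -- Two non-adjacent vertices b₁, b₂ whose neighbours on an induced path are
  -- exactly its ends, and a common neighbour c of b₁, b₂ with no neighbour on
  -- the path, form an ISK4 (isk4-from-path): take the K4 on w 0, w K, b₁, b₂,
  -- subdivide b₁b₂ by c, and replace the edge w 0 w K by the interior of the path.
  module _ (w : ℕ → Fin n) (k : ℕ) (p : InducedPath w (suc (suc k))) (b₁ b₂ c : Fin n)
    (b₁≢b₂ : b₁ ≢ b₂) (b₁≢c : b₁ ≢ c) (b₂≢c : b₂ ≢ c)
    (b₁∉w : ∀ m → m ≤ suc (suc k) → b₁ ≢ w m) (b₂∉w : ∀ m → m ≤ suc (suc k) → b₂ ≢ w m)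
    (c∉w : ∀ m → m ≤ suc (suc k) → c ≢ w m)
    (b₁-ends : ∀ m → m ≤ suc (suc k) → H b₁ (w m) ≡ true → m ≡ 0 ⊎ m ≡ suc (suc k))
    (b₂-ends : ∀ m → m ≤ suc (suc k) → H b₂ (w m) ≡ true → m ≡ 0 ⊎ m ≡ suc (suc k))
    (b₁-w₀ : H b₁ (w 0) ≡ true) (b₁-wK : H b₁ (w (suc (suc k))) ≡ true)
    (b₂-w₀ : H b₂ (w 0) ≡ true) (b₂-wK : H b₂ (w (suc (suc k))) ≡ true)
    (c-w : ∀ m → m ≤ suc (suc k) → H c (w m) ≡ false)
    (b₁≁b₂ : H b₁ b₂ ≡ false) (c-b₁ : H c b₁ ≡ true) (c-b₂ : H c b₂ ≡ true) where
    private
      open InducedPath p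
      K : ℕ
      K = suc (suc k)
      w₀≢wK : w 0 ≢ w K
      w₀≢wK e = case injective 0 K z≤n ≤-refl e of λ ()
      -- The K4 on w 0, w K, b₁, b₂ with b₁b₂ subdivided by c (vertex 0 of
      -- subdivide K4 2 3); it is induced except on w 0 w K.
      frame : Fin 5 → Fin n
      frame = extend c (extend (w 0) (extend (w K) (extend b₁ (extend b₂ nowhere))))
      frame-injective : Injective _≡_ _≡_ frame
      frame-injective =
        extend-injective (extend-injective (extend-injective (extend-injective
          (extend-injective nowhere-injective (λ ()))
          (λ { zero → b₁≢b₂ }))
          (λ { zero e → b₁∉w K ≤-refl (sym e) ; (suc zero) e → b₂∉w K ≤-refl (sym e) }))
          (λ { zero → w₀≢wK ; (suc zero) e → b₁∉w 0 z≤n (sym e) ; (suc (suc zero)) e → b₂∉w 0 z≤n (sym e) }))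
          (λ { zero → c∉w 0 z≤n ; (suc zero) → c∉w K ≤-refl
             ; (suc (suc zero)) e → b₁≢c (sym e) ; (suc (suc (suc zero))) e → b₂≢c (sym e) })
      frame-induced : InducedExcept (subdivide K4 (suc (suc zero)) (suc (suc (suc zero)))) at-w₀ at-wK frame
      frame-induced at-c  at-c  i≢j _ _ = ⊥-elim (i≢j refl)
      frame-induced at-c  at-w₀ _ _ _ = c-w 0 z≤n
      frame-induced at-c  at-wK _ _ _ = c-w K ≤-refl
      frame-induced at-c  at-b₁ _ _ _ = c-b₁
      frame-induced at-c  at-b₂ _ _ _ = c-b₂
      frame-induced at-w₀ at-c  _ _ _ = trans (H-sym _ _) (c-w 0 z≤n)
      frame-induced at-w₀ at-w₀ i≢j _ _ = ⊥-elim (i≢j refl)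
      frame-induced at-w₀ at-wK _ ¬uv _ = ⊥-elim (¬uv (refl , refl))
      frame-induced at-w₀ at-b₁ _ _ _ = trans (H-sym _ _) b₁-w₀
      frame-induced at-w₀ at-b₂ _ _ _ = trans (H-sym _ _) b₂-w₀
      frame-induced at-wK at-c  _ _ _ = trans (H-sym _ _) (c-w K ≤-refl)
      frame-induced at-wK at-w₀ _ _ ¬vu = ⊥-elim (¬vu (refl , refl))
      frame-induced at-wK at-wK i≢j _ _ = ⊥-elim (i≢j refl)
      frame-induced at-wK at-b₁ _ _ _ = trans (H-sym _ _) b₁-wK
      frame-induced at-wK at-b₂ _ _ _ = trans (H-sym _ _) b₂-wK
      frame-induced at-b₁ at-c  _ _ _ = trans (H-sym _ _) c-b₁
      frame-induced at-b₁ at-w₀ _ _ _ = b₁-w₀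
      frame-induced at-b₁ at-wK _ _ _ = b₁-wK
      frame-induced at-b₁ at-b₁ i≢j _ _ = ⊥-elim (i≢j refl)
      frame-induced at-b₁ at-b₂ _ _ _ = b₁≁b₂
      frame-induced at-b₂ at-c  _ _ _ = trans (H-sym _ _) c-b₂
      frame-induced at-b₂ at-w₀ _ _ _ = b₂-w₀
      frame-induced at-b₂ at-wK _ _ _ = b₂-wK
      frame-induced at-b₂ at-b₁ _ _ _ = trans (H-sym _ _) b₁≁b₂
      frame-induced at-b₂ at-b₂ i≢j _ _ = ⊥-elim (i≢j refl)
      inner : ∀ {i} → i < suc k → suc i ≤ K
      inner = m≤n⇒m≤1+n
      interior : Detour frame at-w₀ at-wK (suc k) (w ∘ suc)
      interior = record
        { injective   = λ i j li lj e → suc-injective (injective (suc i) (suc j) (inner li) (inner lj) e)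
        ; avoids      = avoids
        ; edges       = λ i si<L → edges (suc i) (inner si<L)
        ; chordless   = chordless′
        ; attachments = attachments
        ; ends        = ¬-not (λ h → case chordless 0 K (s≤s z≤n) ≤-refl h of λ ())
                        , trans (H-sym _ _) (edges 0 (s≤s z≤n))
                        , edges (suc k) ≤-refl
        }
        where
        avoids : ∀ i j → i < suc k → w (suc i) ≢ frame j
        avoids i at-c  li e = c∉w (suc i) (inner li) (sym e)
        avoids i at-w₀ li e = case injective (suc i) 0 (inner li) z≤n e of λ ()
        avoids i at-wK li e = <-irrefl (suc-injective (injective (suc i) K (inner li) ≤-refl e)) li
        avoids i at-b₁ li e = b₁∉w (suc i) (inner li) (sym e)
        avoids i at-b₂ li e = b₂∉w (suc i) (inner li) (sym e)
        chordless′ : ∀ i j → i < suc k → j < suc k → i ≢ j → H (w (suc i)) (w (suc j)) ≡ true → j ≡ suc i ⊎ i ≡ suc j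
        chordless′ i j li lj i≢j h with <-cmp i j
        ... | tri< lt _ _ = inj₁ (suc-injective (chordless (suc i) (suc j) (s≤s lt) (inner lj) h))
        ... | tri≈ _ e _  = ⊥-elim (i≢j e)
        ... | tri> _ _ gt = inj₂ (suc-injective (chordless (suc j) (suc i) (s≤s gt) (inner li) (trans (H-sym _ _) h)))
        attachments : ∀ i j → i < suc k → H (w (suc i)) (frame j) ≡ true → (i ≡ 0 × j ≡ at-w₀) ⊎ (suc i ≡ suc k × j ≡ at-wK)
        attachments i at-c li h = ⊥-elim (case trans (sym (c-w (suc i) (inner li))) (trans (H-sym _ _) h) of λ ())
        attachments i at-w₀ li h = inj₁ (suc-injective (chordless 0 (suc i) (s≤s z≤n) (inner li) (trans (H-sym _ _) h)) , refl)
        attachments i at-wK li h = inj₂ (sym (suc-injective (chordless (suc i) K (s≤s li) ≤-refl h)) , refl)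
        attachments i at-b₁ li h with b₁-ends (suc i) (inner li) (trans (H-sym _ _) h)
        ... | inj₂ e = ⊥-elim (<-irrefl (suc-injective e) li)
        attachments i at-b₂ li h with b₂-ends (suc i) (inner li) (trans (H-sym _ _) h)
        ... | inj₂ e = ⊥-elim (<-irrefl (suc-injective e) li)

    isk4-from-path : ContainsISK4 H
    isk4-from-path = isk4-from-detour (sub k4 (λ ()) refl) (λ ()) refl frame-injective frame-induced interior

_≟-adj_ : (a b : Adjacency) → Dec (a ≡ b)
strong ≟-adj strong = yes refl
strong ≟-adj semi   = no (λ ())
strong ≟-adj anti   = no (λ ())
semi   ≟-adj strong = no (λ ())
semi   ≟-adj semi   = yes refl
semi   ≟-adj anti   = no (λ ())
anti   ≟-adj strong = no (λ ())
anti   ≟-adj semi   = no (λ ())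
anti   ≟-adj anti   = yes refl

x∉p-x : ∀ {n} (p : Subset n) (x : Fin n) → x ∉ p - x
x∉p-x (_ ∷ p) zero    ()
x∉p-x (_ ∷ p) (suc x) (there x∈) = x∉p-x p x x∈

module Reachability {n : ℕ} (G : Trigraph n) where

  adjacent? : ∀ u w → Dec (Adjacent G u w)
  adjacent? u w with θ G u w ≟-adj anti
  ... | yes isAnti = no (λ ¬anti → ¬anti isAnti)
  ... | no ¬anti = yes ¬anti

  adjacent-sym : ∀ {u w} → Adjacent G u w → Adjacent G w u
  adjacent-sym {u} {w} uw e = uw (trans (θ-sym G u w) e)

  reach-start : ∀ {S u v} → Reach G S u v → u ∈ S
  reach-start (here u∈) = u∈
  reach-start (step u∈ _ _) = u∈

  reach-end : ∀ {S u v} → Reach G S u v → v ∈ S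
  reach-end (here v∈) = v∈
  reach-end (step _ _ r) = reach-end r

  reach-mono : ∀ {S S′} → S ⊆ S′ → ∀ {u v} → Reach G S u v → Reach G S′ u v
  reach-mono S⊆S′ (here u∈) = here (S⊆S′ u∈)
  reach-mono S⊆S′ (step u∈ a r) = step (S⊆S′ u∈) a (reach-mono S⊆S′ r)

  reach-trans : ∀ {S u w v} → Reach G S u w → Reach G S w v → Reach G S u v
  reach-trans (here _) r = r
  reach-trans (step u∈ a r₁) r = step u∈ a (reach-trans r₁ r)

  reach-snoc : ∀ {S u w v} → Reach G S u w → Adjacent G w v → v ∈ S → Reach G S u v
  reach-snoc r a v∈ = reach-trans r (step (reach-end r) a (here v∈))

  reach-sym : ∀ {S u v} → Reach G S u v → Reach G S v u
  reach-sym (here u∈) = here u∈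
  reach-sym (step u∈ a r) = reach-snoc (reach-sym r) (adjacent-sym a) u∈

  reach-split : ∀ {S w v} (u : Fin n) → Reach G S w v →
    Reach G (S - u) w v ⊎ (u ≡ v ⊎ ∃ λ w′ → Adjacent G u w′ × Reach G (S - u) w′ v)
  reach-split {w = w} u (here w∈) with w ≟ u
  ... | yes refl = inj₂ (inj₁ refl)
  ... | no w≢u = inj₁ (here (x∈p∧x≢y⇒x∈p-y w∈ w≢u))
  reach-split {w = w} u (step {w = w₂} w∈ a r) with reach-split u r
  ... | inj₂ through-u = inj₂ through-u
  ... | inj₁ r′ with w ≟ u
  ...   | yes refl = inj₂ (inj₂ (w₂ , a , r′))
  ...   | no w≢u = inj₁ (step (x∈p∧x≢y⇒x∈p-y w∈ w≢u) a r′)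

  -- Reachability is decidable, by recursion on the size of S (the fuel f
  -- bounds ∣ S ∣): a path from u either is trivial or continues in S - u.
  reach?-fuel : ∀ (f : ℕ) (S : Subset n) → ∣ S ∣ < f → ∀ u v → Dec (Reach G S u v)
  reach?-fuel zero    S ()
  reach?-fuel (suc f) S (s≤s ∣S∣≤f) u v with u ∈? S
  ... | no u∉ = no (λ r → u∉ (reach-start r))
  ... | yes u∈ with u ≟ v
  ...   | yes refl = yes (here u∈)
  ...   | no u≢v with any? (λ w → adjacent? u w ×-dec reach?-fuel f (S - u) (<-≤-trans (x∈p⇒∣p-x∣<∣p∣ u∈) ∣S∣≤f) w v)
  ...     | yes (w , a , r) = yes (step u∈ a (reach-mono (p─q⊆p S ⁅ u ⁆) r))
  ...     | no none = no (λ r → impossible (reach-split u r))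
    where
    impossible : _ → ⊥
    impossible (inj₁ r′) = x∉p-x S u (reach-start r′)
    impossible (inj₂ (inj₁ u≡v)) = u≢v u≡v
    impossible (inj₂ (inj₂ (w′ , a , r′))) = none (w′ , a , r′)

  reach? : ∀ S u v → Dec (Reach G S u v)
  reach? S = reach?-fuel (suc ∣ S ∣) S ≤-refl

  reach→walk : ∀ {S u v} → Reach G S u v → Σ ℕ λ k → Σ (ℕ → Fin n) λ p → p 0 ≡ u × p k ≡ v ×
    (∀ m → m < suc k → p m ∈ S) × (∀ m → suc m < suc k → Adjacent G (p m) (p (suc m)))
  reach→walk {u = u} (here u∈) = 0 , (λ _ → u) , refl , refl , (λ _ _ → u∈) , (λ { m (s≤s ()) })
  reach→walk {S} {u = u} (step u∈ a r) with reach→walk r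
  ... | k , p , p₀ , pk , inside , steps = suc k , p′ , refl , pk , inside′ , steps′
    where
    p′ : ℕ → Fin n
    p′ zero    = u
    p′ (suc m) = p m
    inside′ : ∀ m → m < suc (suc k) → p′ m ∈ S
    inside′ zero    _  = u∈
    inside′ (suc m) lt = inside m (≤-pred lt)
    steps′ : ∀ m → suc m < suc (suc k) → Adjacent G (p′ m) (p′ (suc m))
    steps′ zero    _  = subst (Adjacent G u) (sym p₀) a
    steps′ (suc m) lt = steps m (≤-pred lt)

fullEdge : Adjacency → Bool
fullEdge strong = true
fullEdge semi   = true
fullEdge anti   = false

fullEdge-adjacent : ∀ {a} → a ≢ anti → fullEdge a ≡ true
fullEdge-adjacent {strong} _ = refl
fullEdge-adjacent {semi}   _ = refl
fullEdge-adjacent {anti}   a≢anti = ⊥-elim (a≢anti refl)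

fullEdge-true : ∀ {a} → fullEdge a ≡ true → a ≢ anti
fullEdge-true {strong} _ ()
fullEdge-true {semi}   _ ()

fullEdge-false : ∀ {a} → fullEdge a ≡ false → a ≡ anti
fullEdge-false {anti} _ = refl

fullRealization : ∀ {n} (G : Trigraph n) → Realization G
fullRealization G = record
  { edge        = λ u v → fullEdge (θ G u v)
  ; edge-sym    = λ u v → cong fullEdge (θ-sym G u v)
  ; edge-strong = λ u v _ e → cong fullEdge e
  ; edge-anti   = λ u v _ e → cong fullEdge e
  }

toggledRealization : ∀ {n} (G : Trigraph n) (v x₀ : Fin n) → θ G v x₀ ≡ semi → Realization G
toggledRealization G v x₀ semi-pair = record
  { edge        = λ u w → fullEdge (θ G u w) ∧ not (isPair v x₀ u w)
  ; edge-sym    = λ u w → cong₂ (λ a p → fullEdge a ∧ not p) (θ-sym G u w) (isPair-sym v x₀ u w)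
  ; edge-strong = λ u w _ e → keeps-strong u w e
  ; edge-anti   = λ u w _ e → cong (λ a → fullEdge a ∧ not (isPair v x₀ u w)) e
  }
  where
  keeps-strong : ∀ u w → θ G u w ≡ strong → fullEdge (θ G u w) ∧ not (isPair v x₀ u w) ≡ true
  keeps-strong u w e rewrite e | isPair-other {u = v} {x₀} u w
      (λ { (refl , refl) → case trans (sym e) semi-pair of λ () })
      (λ { (refl , refl) → case trans (sym e) (trans (θ-sym G x₀ v) semi-pair) of λ () }) = refl

record Frame {n} (G : Trigraph n) (X Y : Subset n) : Set where
  field
    X-stable : StronglyStable G X
    Y-stable : StronglyStable G Y
    complete : ∀ u v → u ∈ X → v ∈ Y → θ G u v ≡ strong
    disjoint : ∀ u → u ∈ X → u ∉ Y
    x₁ x₂ x₃ y₁ y₂ y₃ : Fin n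
    x₁∈ : x₁ ∈ X
    x₂∈ : x₂ ∈ X
    x₃∈ : x₃ ∈ X
    y₁∈ : y₁ ∈ Y
    y₂∈ : y₂ ∈ Y
    y₃∈ : y₃ ∈ Y
    x₁≢x₂ : x₁ ≢ x₂
    x₁≢x₃ : x₁ ≢ x₃
    x₂≢x₃ : x₂ ≢ x₃
    y₁≢y₂ : y₁ ≢ y₂
    y₁≢y₃ : y₁ ≢ y₃
    y₂≢y₃ : y₂ ≢ y₃

swap-frame : ∀ {n} {G : Trigraph n} {X Y} → Frame G X Y → Frame G Y X
swap-frame {G = G} F = record
  { X-stable = Y-stable ; Y-stable = X-stable
  ; complete = λ u v u∈Y v∈X → trans (θ-sym G u v) (complete v u v∈X u∈Y)
  ; disjoint = λ u u∈Y u∈X → disjoint u u∈X u∈Y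
  ; x₁ = y₁ ; x₂ = y₂ ; x₃ = y₃ ; y₁ = x₁ ; y₂ = x₂ ; y₃ = x₃
  ; x₁∈ = y₁∈ ; x₂∈ = y₂∈ ; x₃∈ = y₃∈ ; y₁∈ = x₁∈ ; y₂∈ = x₂∈ ; y₃∈ = x₃∈
  ; x₁≢x₂ = y₁≢y₂ ; x₁≢x₃ = y₁≢y₃ ; x₂≢x₃ = y₂≢y₃ ; y₁≢y₂ = x₁≢x₂ ; y₁≢y₃ = x₁≢x₃ ; y₂≢y₃ = x₂≢x₃ }
  where open Frame F

-- Index arithmetic for cutting a segment out of a walk.
skip-repeat-length : ∀ i o r → suc (i + r) + suc o ≡ suc (suc (i + o)) + r
skip-repeat-length = solve-∀

skip-chord-length : ∀ i o r → suc (suc (i + r)) + suc o ≡ suc (suc (suc (i + o))) + r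
skip-chord-length = solve-∀

module InRealization {n} (G : Trigraph n) (R : Realization G)
         (no-isk4 : ¬ ContainsISK4 (edge R)) (no-wheel : ¬ ContainsWheel (edge R)) where

  H : Graph n
  H = edge R

  H-sym : ∀ u v → H u v ≡ H v u
  H-sym = edge-sym R

  open InducedStructures H H-sym

  Attached : Subset n → (ℕ → Fin n) → ℕ → Fin n → Set
  Attached S p k x = x ∈ S × ∃ λ m → m < k × H x (p m) ≡ true

  DoublyAttached : Subset n → (ℕ → Fin n) → ℕ → Set
  DoublyAttached S p k = Σ (Fin n) λ x → Σ (Fin n) λ x′ → x ≢ x′ × Attached S p k x × Attached S p k x′

  attached? : ∀ S p k x → Dec (Attached S p k x)
  attached? S p k x = (x ∈? S) ×-dec anyUpTo? (λ m → H x (p m) ≟-bool true) k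

  doublyAttached? : ∀ S p k → Dec (DoublyAttached S p k)
  doublyAttached? S p k =
    any? λ x → any? λ x′ → ¬? (x ≟ x′) ×-dec (attached? S p k x ×-dec attached? S p k x′)

  attached-split : ∀ {S p k x} → Attached S p (suc (suc k)) x →
    Attached S p (suc k) x ⊎ Attached S (p ∘ suc) (suc k) x
  attached-split {k = k} (x∈ , m , lt , h) with m≤n⇒m<n∨m≡n (≤-pred lt)
  ... | inj₁ lt′ = inj₁ (x∈ , m , lt′ , h)
  ... | inj₂ refl = inj₂ (x∈ , k , ≤-refl , h)

  record OutsideWalk (p : ℕ → Fin n) (k : ℕ) (X Y : Subset n) : Set where
    field
      avoids-X : ∀ m → m < k → p m ∉ X
      avoids-Y : ∀ m → m < k → p m ∉ Y
      steps    : ∀ m → suc m < k → H (p m) (p (suc m)) ≡ true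

  swap-walk : ∀ {p k X Y} → OutsideWalk p k X Y → OutsideWalk p k Y X
  swap-walk w = record { avoids-X = avoids-Y ; avoids-Y = avoids-X ; steps = steps }
    where open OutsideWalk w

  walk-init : ∀ {p k X Y} → OutsideWalk p (suc k) X Y → OutsideWalk p k X Y
  walk-init w = record { avoids-X = λ m lt → avoids-X m (m≤n⇒m≤1+n lt)
                       ; avoids-Y = λ m lt → avoids-Y m (m≤n⇒m≤1+n lt)
                       ; steps    = λ m lt → steps m (m≤n⇒m≤1+n lt) }
    where open OutsideWalk w

  walk-tail : ∀ {p k X Y} → OutsideWalk p (suc k) X Y → OutsideWalk (p ∘ suc) k X Y
  walk-tail w = record { avoids-X = λ m lt → avoids-X (suc m) (s≤s lt)
                       ; avoids-Y = λ m lt → avoids-Y (suc m) (s≤s lt)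
                       ; steps    = λ m lt → steps (suc m) (s≤s lt) }
    where open OutsideWalk w

  NoExtension : Subset n → Subset n → Set
  NoExtension X Y = ∀ v → v ∉ X → v ∉ Y →
    (∀ x → x ∈ X → H v x ≡ true) → (∀ y → y ∈ Y → H v y ≡ false) → ⊥

  skip : ℕ → ℕ → (ℕ → Fin n) → ℕ → Fin n
  skip i D p m with m ≤? i
  ... | yes _ = p m
  ... | no _  = p (m + D)

  skip-before : ∀ {i D p m} → m ≤ i → skip i D p m ≡ p m
  skip-before {i} {m = m} m≤i with m ≤? i
  ... | yes _  = refl
  ... | no m≰i = ⊥-elim (m≰i m≤i)

  skip-after : ∀ {i D p m} → i < m → skip i D p m ≡ p (m + D)
  skip-after {i} {m = m} i<m with m ≤? i
  ... | yes m≤i = ⊥-elim (<-irrefl refl (≤-<-trans m≤i i<m))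
  ... | no _    = refl

  skip-cases : ∀ i D p m → (m ≤ i × skip i D p m ≡ p m) ⊎ (i < m × skip i D p m ≡ p (m + D))
  skip-cases i D p m with m ≤? i
  ... | yes m≤i = inj₁ (m≤i , refl)
  ... | no m≰i  = inj₂ (≰⇒> m≰i , refl)

  -- Cutting out a segment whose two sides are joined (bridge), or which
  -- reaches the end of the walk (end), leaves a shorter walk from p 0 to the
  -- same last vertex.
  skip-walk : ∀ {X Y} k i d p → i ≤ k → OutsideWalk p (suc k + suc d) X Y →
    (suc (i + suc d) < suc k + suc d → H (p i) (p (suc (i + suc d))) ≡ true) →
    (suc (i + suc d) ≡ suc k + suc d → p i ≡ p (k + suc d)) →
    OutsideWalk (skip i (suc d) p) (suc k) X Y × skip i (suc d) p 0 ≡ p 0 × skip i (suc d) p k ≡ p (k + suc d)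
  skip-walk {X} {Y} k i d p i≤k w bridge end = walk′ , skip-before {i} {D} {p} z≤n , last′
    where
    D = suc d
    open OutsideWalk w
    q = skip i D p
    early : ∀ {m} → m < suc k → m < suc k + D
    early lt = ≤-trans lt (m≤m+n _ D)
    late : ∀ {m} → m < suc k → m + D < suc k + D
    late = +-monoˡ-< D
    avoids : ∀ {S} → (∀ m → m < suc k + D → p m ∉ S) → ∀ m → m < suc k → q m ∉ S
    avoids {S} out m lt with skip-cases i D p m
    ... | inj₁ (_ , e) = subst (_∉ S) (sym e) (out m (early lt))
    ... | inj₂ (_ , e) = subst (_∉ S) (sym e) (out (m + D) (late lt))
    steps′ : ∀ m → suc m < suc k → H (q m) (q (suc m)) ≡ true
    steps′ m lt with <-cmp m i
    ... | tri< m<i _ _ = subst₂ (λ u v → H u v ≡ true) (sym (skip-before {i} {D} {p} (<⇒≤ m<i)))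
                           (sym (skip-before {i} {D} {p} m<i)) (steps m (early lt))
    ... | tri≈ _ refl _ = subst₂ (λ u v → H u v ≡ true) (sym (skip-before {i} {D} {p} ≤-refl))
                           (sym (skip-after {i} {D} {p} ≤-refl)) (bridge (late lt))
    ... | tri> _ _ i<m = subst₂ (λ u v → H u v ≡ true) (sym (skip-after {i} {D} {p} i<m))
                           (sym (skip-after {i} {D} {p} (m≤n⇒m≤1+n i<m))) (steps (m + D) (late lt))
    walk′ : OutsideWalk q (suc k) X Y
    walk′ = record { avoids-X = avoids avoids-X ; avoids-Y = avoids avoids-Y ; steps = steps′ }
    last′ : q k ≡ p (k + D)
    last′ with <-cmp k i
    ... | tri< k<i _ _ = ⊥-elim (<-irrefl refl (<-≤-trans k<i i≤k))
    ... | tri≈ _ refl _ = trans (skip-before {i} {D} {p} ≤-refl) (end refl)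
    ... | tri> _ _ i<k = skip-after {i} {D} {p} i<k

  bracket : Fin n → (ℕ → Fin n) → ℕ → Fin n → ℕ → Fin n
  bracket a p k a′ zero = a
  bracket a p k a′ (suc m) with m <? k
  ... | yes _ = p m
  ... | no _  = a′

  bracket-inner : ∀ {a p k a′ m} → m < k → bracket a p k a′ (suc m) ≡ p m
  bracket-inner {k = k} {m = m} lt with m <? k
  ... | yes _ = refl
  ... | no ¬lt = ⊥-elim (¬lt lt)

  bracket-last : ∀ {a p k a′} → bracket a p k a′ (suc k) ≡ a′
  bracket-last {k = k} with k <? k
  ... | yes lt = ⊥-elim (<-irrefl refl lt)
  ... | no _ = refl

  data BracketIndex (k i : ℕ) : Set where
    first : i ≡ 0 → BracketIndex k i
    inner : ∀ m → m < k → i ≡ suc m → BracketIndex k i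
    last  : i ≡ suc k → BracketIndex k i

  bracket-index : ∀ k i → i ≤ suc k → BracketIndex k i
  bracket-index k zero    _ = first refl
  bracket-index k (suc m) le with m≤n⇒m<n∨m≡n (≤-pred le)
  ... | inj₁ lt = inner m lt refl
  ... | inj₂ refl = last refl

  bracket-induced : ∀ a a′ p k →
    (∀ m → m < suc k → a ≢ p m) → (∀ m → m < suc k → a′ ≢ p m) → a ≢ a′ →
    (∀ i j → i < suc k → j < suc k → p i ≡ p j → i ≡ j) →
    (∀ i j → i < j → j < suc k → H (p i) (p j) ≡ true → j ≡ suc i) →
    (∀ m → suc m < suc k → H (p m) (p (suc m)) ≡ true) →
    (∀ m → m < suc k → H a (p m) ≡ true → m ≡ 0) → H a (p 0) ≡ true →
    (∀ m → m < suc k → H (p m) a′ ≡ true → m ≡ k) → H (p k) a′ ≡ true →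
    H a a′ ≡ false → InducedPath (bracket a p (suc k) a′) (suc (suc k))
  bracket-induced a a′ p k a∉p a′∉p a≢a′ p-inj p-chordless p-steps a-first a-p₀ a′-last p-a′ a≁a′ =
    record { injective = injective ; chordless = chordless ; edges = edges }
    where
    K = suc k
    w = bracket a p K a′
    mid : ∀ {m} → m < K → w (suc m) ≡ p m
    mid = bracket-inner {a} {p} {K} {a′}
    end : w (suc K) ≡ a′
    end = bracket-last {a} {p} {K} {a′}
    injective : ∀ i j → i ≤ suc K → j ≤ suc K → w i ≡ w j → i ≡ j
    injective i j li lj e with bracket-index K i li | bracket-index K j lj
    ... | first refl     | first refl      = refl
    ... | first refl     | inner m lt refl = ⊥-elim (a∉p m lt (trans e (mid lt)))
    ... | first refl     | last refl       = ⊥-elim (a≢a′ (trans e end))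
    ... | inner m lt refl | first refl     = ⊥-elim (a∉p m lt (sym (trans (sym (mid lt)) e)))
    ... | inner m lt refl | inner m′ lt′ refl = cong suc (p-inj m m′ lt lt′ (trans (sym (mid lt)) (trans e (mid lt′))))
    ... | inner m lt refl | last refl      = ⊥-elim (a′∉p m lt (sym (trans (sym (mid lt)) (trans e end))))
    ... | last refl      | first refl      = ⊥-elim (a≢a′ (sym (trans (sym end) e)))
    ... | last refl      | inner m lt refl = ⊥-elim (a′∉p m lt (trans (sym end) (trans e (mid lt))))
    ... | last refl      | last refl       = refl
    chordless : ∀ i j → i < j → j ≤ suc K → H (w i) (w j) ≡ true → j ≡ suc i
    chordless i j lt lj h with bracket-index K i (≤-trans (<⇒≤ lt) lj) | bracket-index K j lj
    ... | first refl      | first refl      = ⊥-elim (<-irrefl refl lt)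
    ... | first refl      | inner m lm refl = cong suc (a-first m lm (subst (λ z → H a z ≡ true) (mid lm) h))
    ... | first refl      | last refl       = ⊥-elim (case trans (sym a≁a′) (subst (λ z → H a z ≡ true) end h) of λ ())
    ... | inner m lm refl | first refl      = ⊥-elim (case lt of λ ())
    ... | inner m lm refl | inner m′ lm′ refl =
      cong suc (p-chordless m m′ (≤-pred lt) lm′ (subst₂ (λ u v → H u v ≡ true) (mid lm) (mid lm′) h))
    ... | inner m lm refl | last refl       =
      cong (λ z → suc (suc z)) (sym (a′-last m lm (subst₂ (λ u v → H u v ≡ true) (mid lm) end h)))
    ... | last refl       | _               = ⊥-elim (<-irrefl refl (<-≤-trans lt lj))
    edges : ∀ i → i < suc K → H (w i) (w (suc i)) ≡ true
    edges i lt with bracket-index K i (<⇒≤ lt)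
    ... | first refl = subst (λ z → H a z ≡ true) (sym (mid (s≤s z≤n))) a-p₀
    ... | inner m lm refl with m≤n⇒m<n∨m≡n (≤-pred lt)
    ...   | inj₁ sm<K = subst₂ (λ u v → H u v ≡ true) (sym (mid lm)) (sym (mid sm<K)) (p-steps m sm<K)
    ...   | inj₂ refl = subst₂ (λ u v → H u v ≡ true) (sym (mid lm)) (sym end) p-a′
    edges i lt | last refl = ⊥-elim (<-irrefl refl lt)

  bracket-avoids : ∀ a a′ p k z → z ≢ a → z ≢ a′ → (∀ m → m < k → z ≢ p m) →
    ∀ m → m ≤ suc k → z ≢ bracket a p k a′ m
  bracket-avoids a a′ p k z z≢a z≢a′ z∉p m lm with bracket-index k m lm
  ... | first refl = z≢a
  ... | inner m′ lt refl = λ e → z∉p m′ lt (trans e (bracket-inner {a} {p} {k} {a′} lt))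
  ... | last refl = λ e → z≢a′ (trans e (bracket-last {a} {p} {k} {a′}))

  bracket-ends-only : ∀ a a′ p k z → (∀ m → m < k → H z (p m) ≡ false) →
    ∀ m → m ≤ suc k → H z (bracket a p k a′ m) ≡ true → m ≡ 0 ⊎ m ≡ suc k
  bracket-ends-only a a′ p k z z≁p m lm h with bracket-index k m lm
  ... | first refl = inj₁ refl
  ... | inner m′ lt refl =
    ⊥-elim (case trans (sym (z≁p m′ lt)) (subst (λ u → H z u ≡ true) (bracket-inner {a} {p} {k} {a′} lt) h) of λ ())
  ... | last refl = inj₂ refl

  bracket-anticomplete : ∀ a a′ p k z → H z a ≡ false → H z a′ ≡ false → (∀ m → m < k → H z (p m) ≡ false) →
    ∀ m → m ≤ suc k → H z (bracket a p k a′ m) ≡ false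
  bracket-anticomplete a a′ p k z z≁a z≁a′ z≁p m lm with bracket-index k m lm
  ... | first refl = z≁a
  ... | inner m′ lt refl = trans (cong (H z) (bracket-inner {a} {p} {k} {a′} lt)) (z≁p m′ lt)
  ... | last refl = trans (cong (H z) (bracket-last {a} {p} {k} {a′})) z≁a′

  module OnFrame {X Y : Subset n} (F : Frame G X Y) where
    open Frame F

    X≢Y : ∀ {u v} → u ∈ X → v ∈ Y → u ≢ v
    X≢Y {u} u∈X v∈Y e = disjoint u u∈X (subst (_∈ Y) (sym e) v∈Y)

    X~Y : ∀ {u v} → u ∈ X → v ∈ Y → H u v ≡ true
    X~Y {u} {v} u∈X v∈Y = edge-strong R u v (X≢Y u∈X v∈Y) (complete u v u∈X v∈Y)

    Y~X : ∀ {u v} → u ∈ Y → v ∈ X → H u v ≡ true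
    Y~X u∈Y v∈X = trans (H-sym _ _) (X~Y v∈X u∈Y)

    X≁X : ∀ {u v} → u ∈ X → v ∈ X → u ≢ v → H u v ≡ false
    X≁X {u} {v} u∈X v∈X u≢v = edge-anti R u v u≢v (X-stable u v u∈X v∈X u≢v)

    Y≁Y : ∀ {u v} → u ∈ Y → v ∈ Y → u ≢ v → H u v ≡ false
    Y≁Y {u} {v} u∈Y v∈Y u≢v = edge-anti R u v u≢v (Y-stable u v u∈Y v∈Y u≢v)

    ∈∉-distinct : ∀ {S : Subset n} {u v} → u ∈ S → v ∉ S → u ≢ v
    ∈∉-distinct {S} u∈S v∉S e = v∉S (subst (_∈ S) e u∈S)

    other-in-Y : (b : Fin n) → Σ (Fin n) λ y → y ∈ Y × y ≢ b
    other-in-Y b with y₁ ≟ b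
    ... | yes refl = y₂ , y₂∈ , (λ e → y₁≢y₂ (sym e))
    ... | no y₁≢b  = y₁ , y₁∈ , y₁≢b

    other-in-X : (a a′ : Fin n) → Σ (Fin n) λ c → c ∈ X × c ≢ a × c ≢ a′
    other-in-X a a′ with x₁ ≟ a | x₁ ≟ a′
    ... | no x₁≢a | no x₁≢a′ = x₁ , x₁∈ , x₁≢a , x₁≢a′
    ... | yes refl | _ with x₂ ≟ a′
    ...   | no x₂≢a′ = x₂ , x₂∈ , (λ e → x₁≢x₂ (sym e)) , x₂≢a′
    ...   | yes refl = x₃ , x₃∈ , (λ e → x₁≢x₃ (sym e)) , (λ e → x₂≢x₃ (sym e))
    other-in-X a a′ | no x₁≢a | yes refl with x₂ ≟ a
    ...   | no x₂≢a = x₂ , x₂∈ , x₂≢a , (λ e → x₁≢x₂ (sym e))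
    ...   | yes refl = x₃ , x₃∈ , (λ e → x₂≢x₃ (sym e)) , (λ e → x₁≢x₃ (sym e))

    path3 : Fin n → Fin n → Fin n → ℕ → Fin n
    path3 x b x′ zero          = x
    path3 x b x′ (suc zero)    = b
    path3 x b x′ (suc (suc _)) = x′

    path3-induced : ∀ x b x′ → x ≢ b → x ≢ x′ → b ≢ x′ → H x x′ ≡ false → H x b ≡ true → H b x′ ≡ true →
      InducedPath (path3 x b x′) 2
    path3-induced x b x′ x≢b x≢x′ b≢x′ x≁x′ x~b b~x′ =
      record { injective = injective ; chordless = chordless ; edges = edges }
      where
      injective : ∀ i j → i ≤ 2 → j ≤ 2 → path3 x b x′ i ≡ path3 x b x′ j → i ≡ j
      injective 0 0 _ _ _ = refl
      injective 0 1 _ _ e = ⊥-elim (x≢b e)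
      injective 0 2 _ _ e = ⊥-elim (x≢x′ e)
      injective 1 0 _ _ e = ⊥-elim (x≢b (sym e))
      injective 1 1 _ _ _ = refl
      injective 1 2 _ _ e = ⊥-elim (b≢x′ e)
      injective 2 0 _ _ e = ⊥-elim (x≢x′ (sym e))
      injective 2 1 _ _ e = ⊥-elim (b≢x′ (sym e))
      injective 2 2 _ _ _ = refl
      injective (suc (suc (suc _))) _ (s≤s (s≤s ())) _ _
      injective _ (suc (suc (suc _))) _ (s≤s (s≤s ())) _
      chordless : ∀ i j → i < j → j ≤ 2 → H (path3 x b x′ i) (path3 x b x′ j) ≡ true → j ≡ suc i
      chordless 0 1 _ _ _ = refl
      chordless 0 2 _ _ h = ⊥-elim (case trans (sym x≁x′) h of λ ())
      chordless 1 2 _ _ _ = refl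
      chordless _ (suc (suc (suc _))) _ (s≤s (s≤s ())) _
      chordless 0 0 () _ _
      chordless 1 0 () _ _
      chordless 1 1 (s≤s ()) _ _
      chordless 2 0 () _ _
      chordless 2 1 (s≤s ()) _ _
      chordless 2 2 (s≤s (s≤s ())) _ _
      chordless (suc (suc (suc _))) 2 (s≤s (s≤s ())) _ _
      edges : ∀ i → i < 2 → H (path3 x b x′ i) (path3 x b x′ (suc i)) ≡ true
      edges 0 _ = x~b
      edges 1 _ = b~x′
      edges (suc (suc _)) (s≤s (s≤s ()))

    -- A vertex v off the frame seeing x, x′ ∈ X and some b ∈ Y is the centre
    -- of a wheel on the hole x, b, x′, b′ (b′ another vertex of Y).
    sees-two-of-X-and-Y : ∀ v x x′ b → v ∉ X → v ∉ Y → x ∈ X → x′ ∈ X → x ≢ x′ → b ∈ Y →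
      H v x ≡ true → H v x′ ≡ true → H v b ≡ true → ⊥
    sees-two-of-X-and-Y v x x′ b v∉X v∉Y x∈X x′∈X x≢x′ b∈Y v~x v~x′ v~b with other-in-Y b
    ... | b′ , b′∈Y , b′≢b =
      no-wheel (wheel-from-path (path3 x b x′) 0
        (path3-induced x b x′ (X≢Y x∈X b∈Y) x≢x′ (λ e → X≢Y x′∈X b∈Y (sym e)) (X≁X x∈X x′∈X x≢x′) (X~Y x∈X b∈Y) (Y~X b∈Y x′∈X))
        b′ v b′∉path b′-ends (Y~X b′∈Y x∈X) (Y~X b′∈Y x′∈X) (∈∉-distinct b′∈Y v∉Y ∘ sym) v∉path
        v~x v~x′ 1 (s≤s z≤n) (s≤s (s≤s z≤n)) v~b)
      where
      b′∉path : ∀ m → m ≤ 2 → b′ ≢ path3 x b x′ m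
      b′∉path 0 _ e = X≢Y x∈X b′∈Y (sym e)
      b′∉path 1 _ e = b′≢b e
      b′∉path 2 _ e = X≢Y x′∈X b′∈Y (sym e)
      b′∉path (suc (suc (suc _))) (s≤s (s≤s ()))
      b′-ends : ∀ m → m ≤ 2 → H b′ (path3 x b x′ m) ≡ true → m ≡ 0 ⊎ m ≡ 2
      b′-ends 0 _ _ = inj₁ refl
      b′-ends 1 _ h = ⊥-elim (case trans (sym (Y≁Y b′∈Y b∈Y b′≢b)) h of λ ())
      b′-ends 2 _ _ = inj₂ refl
      b′-ends (suc (suc (suc _))) (s≤s (s≤s ()))
      v∉path : ∀ m → m ≤ 2 → v ≢ path3 x b x′ m
      v∉path 0 _ e = v∉X (subst (_∈ X) (sym e) x∈X)
      v∉path 1 _ e = v∉Y (subst (_∈ Y) (sym e) b∈Y)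
      v∉path 2 _ e = v∉X (subst (_∈ X) (sym e) x′∈X)
      v∉path (suc (suc (suc _))) (s≤s (s≤s ()))

    -- A vertex v off the frame seeing x, x′ ∈ X, missing c ∈ X and anticomplete
    -- to Y gives an ISK4: the path x, v, x′ with y₁, y₂ and c.
    sees-two-misses-one-of-X : ∀ v x x′ c → v ∉ X → v ∉ Y → x ∈ X → x′ ∈ X → c ∈ X → x ≢ x′ →
      H v x ≡ true → H v x′ ≡ true → H v c ≡ false → (∀ y → y ∈ Y → H v y ≡ false) → ⊥
    sees-two-misses-one-of-X v x x′ c v∉X v∉Y x∈X x′∈X c∈X x≢x′ v~x v~x′ v≁c v≁Y =
      no-isk4 (isk4-from-path w 0
        (path3-induced x v x′ (∈∉-distinct x∈X v∉X) x≢x′ (λ e → v∉X (subst (_∈ X) (sym e) x′∈X))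
                       (X≁X x∈X x′∈X x≢x′) (trans (H-sym _ _) v~x) v~x′)
        y₁ y₂ c y₁≢y₂ (X≢Y c∈X y₁∈ ∘ sym) (X≢Y c∈X y₂∈ ∘ sym) (Y∉path y₁∈) (Y∉path y₂∈) c∉path
        (Y-ends y₁∈) (Y-ends y₂∈) (Y~X y₁∈ x∈X) (Y~X y₁∈ x′∈X) (Y~X y₂∈ x∈X) (Y~X y₂∈ x′∈X)
        c≁path (Y≁Y y₁∈ y₂∈ y₁≢y₂) (X~Y c∈X y₁∈) (X~Y c∈X y₂∈))
      where
      w = path3 x v x′
      c≢x : c ≢ x
      c≢x e = case trans (sym v≁c) (trans (cong (H v) e) v~x) of λ ()
      c≢x′ : c ≢ x′
      c≢x′ e = case trans (sym v≁c) (trans (cong (H v) e) v~x′) of λ ()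
      Y∉path : ∀ {y} → y ∈ Y → ∀ m → m ≤ 2 → y ≢ w m
      Y∉path y∈Y 0 _ e = X≢Y x∈X y∈Y (sym e)
      Y∉path y∈Y 1 _ e = v∉Y (subst (_∈ Y) e y∈Y)
      Y∉path y∈Y 2 _ e = X≢Y x′∈X y∈Y (sym e)
      Y∉path y∈Y (suc (suc (suc _))) (s≤s (s≤s ()))
      c∉path : ∀ m → m ≤ 2 → c ≢ w m
      c∉path 0 _ = c≢x
      c∉path 1 _ e = v∉X (subst (_∈ X) e c∈X)
      c∉path 2 _ = c≢x′
      c∉path (suc (suc (suc _))) (s≤s (s≤s ()))
      Y-ends : ∀ {y} → y ∈ Y → ∀ m → m ≤ 2 → H y (w m) ≡ true → m ≡ 0 ⊎ m ≡ 2
      Y-ends y∈Y 0 _ _ = inj₁ refl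
      Y-ends y∈Y 1 _ h = ⊥-elim (case trans (sym (v≁Y _ y∈Y)) (trans (H-sym _ _) h) of λ ())
      Y-ends y∈Y 2 _ _ = inj₂ refl
      Y-ends y∈Y (suc (suc (suc _))) (s≤s (s≤s ()))
      c≁path : ∀ m → m ≤ 2 → H c (w m) ≡ false
      c≁path 0 _ = X≁X c∈X x∈X c≢x
      c≁path 1 _ = trans (H-sym _ _) v≁c
      c≁path 2 _ = X≁X c∈X x′∈X c≢x′
      c≁path (suc (suc (suc _))) (s≤s (s≤s ()))

    one-vertex-case : NoExtension X Y → ∀ v x x′ → v ∉ X → v ∉ Y → x ∈ X → x′ ∈ X → x ≢ x′ →
      H x v ≡ true → H x′ v ≡ true → ⊥
    one-vertex-case no-ext v x x′ v∉X v∉Y x∈X x′∈X x≢x′ x~v x′~v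
      with any? (λ y → (y ∈? Y) ×-dec (H v y ≟-bool true))
    ... | yes (b , b∈Y , v~b) =
      sees-two-of-X-and-Y v x x′ b v∉X v∉Y x∈X x′∈X x≢x′ b∈Y (trans (H-sym _ _) x~v) (trans (H-sym _ _) x′~v) v~b
    ... | no v≁Y with any? (λ c → (c ∈? X) ×-dec (H v c ≟-bool false))
    ...   | yes (c , c∈X , v≁c) =
      sees-two-misses-one-of-X v x x′ c v∉X v∉Y x∈X x′∈X c∈X x≢x′ (trans (H-sym _ _) x~v) (trans (H-sym _ _) x′~v) v≁c
        (λ y y∈Y → ¬-not (λ h → v≁Y (y , y∈Y , h)))
    ...   | no v~X =
      no-ext v v∉X v∉Y (λ c c∈X → ¬-not (λ h → v~X (c , c∈X , h))) (λ y y∈Y → ¬-not (λ h → v≁Y (y , y∈Y , h)))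

    record AttachmentEnds (p : ℕ → Fin n) (L : ℕ) : Set where
      field
        a a′         : Fin n
        a∈X          : a ∈ X
        a′∈X         : a′ ∈ X
        a≢a′         : a ≢ a′
        a~first      : H a (p 0) ≡ true
        a′~last      : H a′ (p L) ≡ true
        a-only-first : ¬ Attached X (p ∘ suc) L a
        a′-only-last : ¬ Attached X p L a′

    attachment-ends : ∀ L p u v → 0 < L → u ≢ v → Attached X p (suc L) u → Attached X p (suc L) v →
      ¬ Attached X (p ∘ suc) L u → ¬ DoublyAttached X p L → AttachmentEnds p L
    attachment-ends L p u v 0<L u≢v (u∈X , mu , lu , u~) (v∈X , mv , lv , v~) u-only-first clean-init =
      record { a = u ; a′ = v ; a∈X = u∈X ; a′∈X = v∈X ; a≢a′ = u≢v ; a~first = u~first ; a′~last = v~last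
             ; a-only-first = u-only-first ; a′-only-last = v-only-last }
      where
      sees-first : ∀ m → m < suc L → H u (p m) ≡ true → H u (p 0) ≡ true
      sees-first zero    _  h = h
      sees-first (suc m) lt h = ⊥-elim (u-only-first (u∈X , m , ≤-pred lt , h))
      u~first : H u (p 0) ≡ true
      u~first = sees-first mu lu u~
      v-only-last : ¬ Attached X p L v
      v-only-last v-early = clean-init (u , v , u≢v , (u∈X , 0 , 0<L , u~first) , v-early)
      v~last : H v (p L) ≡ true
      v~last with m≤n⇒m<n∨m≡n (≤-pred lv)
      ... | inj₁ lt = ⊥-elim (v-only-last (v∈X , mv , lt , v~))
      ... | inj₂ refl = v~

    unattached-in-Y : ∀ L p → ¬ DoublyAttached Y p (suc L) → ¬ DoublyAttached Y (p ∘ suc) (suc L) →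
      Σ (Fin n) λ y → y ∈ Y × ¬ Attached Y p (suc (suc L)) y
    unattached-in-Y L p clean-init clean-tail
      with attached? Y p (suc (suc L)) y₁ | attached? Y p (suc (suc L)) y₂ | attached? Y p (suc (suc L)) y₃
    ... | no ¬a₁ | _      | _      = y₁ , y₁∈ , ¬a₁
    ... | yes _  | no ¬a₂ | _      = y₂ , y₂∈ , ¬a₂
    ... | yes _  | yes _  | no ¬a₃ = y₃ , y₃∈ , ¬a₃
    ... | yes a₁ | yes a₂ | yes a₃ with attached-split a₁ | attached-split a₂ | attached-split a₃
    ...   | inj₁ i₁ | inj₁ i₂ | _       = ⊥-elim (clean-init (y₁ , y₂ , y₁≢y₂ , i₁ , i₂))
    ...   | inj₁ i₁ | inj₂ _  | inj₁ i₃ = ⊥-elim (clean-init (y₁ , y₃ , y₁≢y₃ , i₁ , i₃))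
    ...   | inj₁ _  | inj₂ t₂ | inj₂ t₃ = ⊥-elim (clean-tail (y₂ , y₃ , y₂≢y₃ , t₂ , t₃))
    ...   | inj₂ _  | inj₁ i₂ | inj₁ i₃ = ⊥-elim (clean-init (y₂ , y₃ , y₂≢y₃ , i₂ , i₃))
    ...   | inj₂ t₁ | inj₁ _  | inj₂ t₃ = ⊥-elim (clean-tail (y₁ , y₃ , y₁≢y₃ , t₁ , t₃))
    ...   | inj₂ t₁ | inj₂ t₂ | _       = ⊥-elim (clean-tail (y₁ , y₂ , y₁≢y₂ , t₁ , t₂))

    HasChord : (ℕ → Fin n) → ℕ → Set
    HasChord p k = Σ ℕ λ j → j < k × Σ ℕ λ i → i < j × (p i ≡ p j ⊎ (suc i < j × H (p i) (p j) ≡ true))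

    hasChord? : ∀ p k → Dec (HasChord p k)
    hasChord? p k = anyUpTo? (λ j → anyUpTo? (λ i → (p i ≟ p j) ⊎-dec ((suc i <? j) ×-dec (H (p i) (p j) ≟-bool true))) j) k

    -- Inductive step of the attachment lemma.  p 0, …, p (k-1) (k = L + 1 ≥ 2)
    -- is an outside walk whose two maximal proper sub-walks are attached to
    -- neither side twice, and no shorter outside walk is doubly attached to X.
    module MinimalWalk (L′ : ℕ) (p : ℕ → Fin n) (walk : OutsideWalk p (suc (suc L′)) X Y)
      (clean-X-init : ¬ DoublyAttached X p (suc L′)) (clean-X-tail : ¬ DoublyAttached X (p ∘ suc) (suc L′))
      (clean-Y-init : ¬ DoublyAttached Y p (suc L′)) (clean-Y-tail : ¬ DoublyAttached Y (p ∘ suc) (suc L′))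
      (shorter : ∀ k′ → k′ < suc (suc L′) → ∀ q → OutsideWalk q k′ X Y → 0 < k′ → DoublyAttached X q k′ → ⊥)
      where
      open OutsideWalk walk
      k L : ℕ
      k = suc (suc L′)
      L = suc L′

      ends : DoublyAttached X p k → AttachmentEnds p L
      ends (x , x′ , x≢x′ , x-att , x′-att) with attached? X (p ∘ suc) L x
      ... | yes x-late = attachment-ends L p x′ x (s≤s z≤n) (x≢x′ ∘ sym) x′-att x-att
                           (λ x′-late → clean-X-tail (x , x′ , x≢x′ , x-late , x′-late)) clean-X-init
      ... | no x-early = attachment-ends L p x x′ (s≤s z≤n) x≢x′ x-att x′-att x-early clean-X-init

      module WithEnds (E : AttachmentEnds p L) where
        open AttachmentEnds E

        -- If a segment can be cut out (see skip-walk), the shorter walk is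
        -- still doubly attached to X, through a and a′.
        cut : ∀ k₀ i o → i ≤ k₀ → suc k₀ + suc o ≡ k →
          (suc (i + suc o) < suc k₀ + suc o → H (p i) (p (suc (i + suc o))) ≡ true) →
          (suc (i + suc o) ≡ suc k₀ + suc o → p i ≡ p (k₀ + suc o)) → ⊥
        cut k₀ i o i≤k₀ length bridge end
          with skip-walk k₀ i o p i≤k₀ (subst (λ z → OutsideWalk p z X Y) (sym length) walk) bridge end
        ... | walk′ , first′ , last′ =
          shorter (suc k₀) (subst (suc k₀ <_) length (m<m+n (suc k₀) (s≤s z≤n))) (skip i (suc o) p) walk′ (s≤s z≤n)
            (a , a′ , a≢a′ , (a∈X , 0 , s≤s z≤n , subst (λ z → H a z ≡ true) (sym first′) a~first)
                           , (a′∈X , k₀ , ≤-refl , subst (λ z → H a′ z ≡ true)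
                                                     (sym (trans last′ (cong p (suc-injective length)))) a′~last))

        -- A repeated vertex p i = p j: cut out p (i+1), …, p j.
        repeat-case : ∀ i j → i < j → j < k → p i ≡ p j → ⊥
        repeat-case i j i<j j<k pi≡pj with m≤n⇒∃[o]m+o≡n i<j | m≤n⇒∃[o]m+o≡n j<k
        ... | o , eo | r , er = cut (i + r) i o (m≤m+n i r) length bridge end
          where
          length : suc (i + r) + suc o ≡ k
          length = trans (skip-repeat-length i o r) (trans (cong (λ z → suc z + r) eo) er)
          j≡ : i + suc o ≡ j
          j≡ = trans (+-suc i o) eo
          bridge : suc (i + suc o) < suc (i + r) + suc o → H (p i) (p (suc (i + suc o))) ≡ true
          bridge lt = subst (λ z → H (p i) (p (suc z)) ≡ true) (sym j≡)
                        (trans (cong (λ z → H z (p (suc j))) pi≡pj) (steps j (subst₂ _<_ (cong suc j≡) length lt)))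
          end : suc (i + suc o) ≡ suc (i + r) + suc o → p i ≡ p ((i + r) + suc o)
          end e = trans pi≡pj (cong p (trans (sym j≡) (suc-injective e)))

        -- A chord p i p j (i + 1 < j): cut out p (i+1), …, p (j-1).
        chord-case : ∀ i j → suc i < j → j < k → H (p i) (p j) ≡ true → ⊥
        chord-case i j si<j j<k chord with m≤n⇒∃[o]m+o≡n si<j | m≤n⇒∃[o]m+o≡n j<k
        ... | o , eo | r , er = cut (suc (i + r)) i o (m≤n⇒m≤1+n (m≤m+n i r)) length bridge end
          where
          length : suc (suc (i + r)) + suc o ≡ k
          length = trans (skip-chord-length i o r) (trans (cong (λ z → suc z + r) eo) er)
          j≡ : suc (i + suc o) ≡ j
          j≡ = trans (cong suc (+-suc i o)) eo
          bridge : suc (i + suc o) < suc (suc (i + r)) + suc o → H (p i) (p (suc (i + suc o))) ≡ true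
          bridge _ = subst (λ z → H (p i) (p z) ≡ true) (sym j≡) chord
          end : suc (i + suc o) ≡ suc (suc (i + r)) + suc o → p i ≡ p (suc (i + r) + suc o)
          end e = ⊥-elim (<-irrefl (trans (sym j≡) (trans e length)) j<k)

        -- Without repeats and chords, a, p 0, …, p (k-1), a′ is an induced path.
        module Chordless (no-chord : ¬ HasChord p k) where
          p-injective : ∀ i j → i < k → j < k → p i ≡ p j → i ≡ j
          p-injective i j i<k j<k e with <-cmp i j
          ... | tri< i<j _ _ = ⊥-elim (no-chord (j , j<k , i , i<j , inj₁ e))
          ... | tri≈ _ i≡j _ = i≡j
          ... | tri> _ _ j<i = ⊥-elim (no-chord (i , i<k , j , j<i , inj₁ (sym e)))

          p-chordless : ∀ i j → i < j → j < k → H (p i) (p j) ≡ true → j ≡ suc i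
          p-chordless i j i<j j<k h with suc i <? j
          ... | yes si<j = ⊥-elim (no-chord (j , j<k , i , i<j , inj₂ (si<j , h)))
          ... | no si≮j = ≤-antisym (≮⇒≥ si≮j) i<j

          a-first-only : ∀ m → m < k → H a (p m) ≡ true → m ≡ 0
          a-first-only zero    _  _ = refl
          a-first-only (suc m) lt h = ⊥-elim (a-only-first (a∈X , m , ≤-pred lt , h))

          a′-last-only : ∀ m → m < k → H (p m) a′ ≡ true → m ≡ L
          a′-last-only m lt h with m≤n⇒m<n∨m≡n (≤-pred lt)
          ... | inj₁ m<L = ⊥-elim (a′-only-last (a′∈X , m , m<L , trans (H-sym _ _) h))
          ... | inj₂ m≡L = m≡L

          X∉walk : ∀ {x} → x ∈ X → ∀ m → m < k → x ≢ p m
          X∉walk x∈X m lt e = avoids-X m lt (subst (_∈ X) e x∈X)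

          w : ℕ → Fin n
          w = bracket a p k a′

          path : InducedPath w (suc k)
          path = bracket-induced a a′ p L (X∉walk a∈X) (X∉walk a′∈X) a≢a′ p-injective p-chordless steps
                   a-first-only a~first a′-last-only (trans (H-sym _ _) a′~last) (X≁X a∈X a′∈X a≢a′)

          Y∉path : ∀ {y} → y ∈ Y → ∀ m → m ≤ suc k → y ≢ w m
          Y∉path y∈Y = bracket-avoids a a′ p k _ (λ e → X≢Y a∈X y∈Y (sym e)) (λ e → X≢Y a′∈X y∈Y (sym e))
                         (λ m lt e → avoids-Y m lt (subst (_∈ Y) e y∈Y))

          Y~last : ∀ {y} → y ∈ Y → H y (w (suc k)) ≡ true
          Y~last y∈Y = subst (λ z → H _ z ≡ true) (sym (bracket-last {a} {p} {k} {a′})) (Y~X y∈Y a′∈X)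

          -- A vertex b ∈ Y attached to the walk is the centre of a wheel whose
          -- hole is the path closed by a vertex of Y not attached to the walk.
          attached-Y-case : ∀ b → Attached Y p k b → ⊥
          attached-Y-case b (b∈Y , i , i<k , b~pi) with unattached-in-Y L′ p clean-Y-init clean-Y-tail
          ... | b′ , b′∈Y , b′-unattached =
            no-wheel (wheel-from-path w L path b′ b (Y∉path b′∈Y)
                       (bracket-ends-only a a′ p k b′ b′≁walk) (Y~X b′∈Y a∈X) (Y~last b′∈Y)
                       b≢b′ (Y∉path b∈Y) (Y~X b∈Y a∈X) (Y~last b∈Y) (suc i) (s≤s z≤n) (s≤s i<k)
                       (subst (λ z → H b z ≡ true) (sym (bracket-inner {a} {p} {k} {a′} i<k)) b~pi))
            where
            b′≁walk : ∀ m → m < k → H b′ (p m) ≡ false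
            b′≁walk m lt = ¬-not (λ h → b′-unattached (b′∈Y , m , lt , h))
            b≢b′ : b ≢ b′
            b≢b′ e = b′-unattached (subst (Attached Y p k) e (b∈Y , i , i<k , b~pi))

          -- If Y is not attached to the walk, y₁ and y₂ see exactly the ends of
          -- the path, and a third vertex c ∈ X sees neither the path (by the
          -- minimality assumptions) nor each other's neighbours: an ISK4.
          unattached-Y-case : (∀ y → ¬ Attached Y p k y) → ⊥
          unattached-Y-case Y-unattached with other-in-X a a′
          ... | c , c∈X , c≢a , c≢a′ =
            no-isk4 (isk4-from-path w L path y₁ y₂ c y₁≢y₂ (λ e → X≢Y c∈X y₁∈ (sym e)) (λ e → X≢Y c∈X y₂∈ (sym e))
                       (Y∉path y₁∈) (Y∉path y₂∈) c∉path
                       (bracket-ends-only a a′ p k y₁ (Y≁walk y₁∈)) (bracket-ends-only a a′ p k y₂ (Y≁walk y₂∈))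
                       (Y~X y₁∈ a∈X) (Y~last y₁∈) (Y~X y₂∈ a∈X) (Y~last y₂∈)
                       (bracket-anticomplete a a′ p k c (X≁X c∈X a∈X c≢a) (X≁X c∈X a′∈X c≢a′) c≁walk)
                       (Y≁Y y₁∈ y₂∈ y₁≢y₂) (X~Y c∈X y₁∈) (X~Y c∈X y₂∈))
            where
            Y≁walk : ∀ {y} → y ∈ Y → ∀ m → m < k → H y (p m) ≡ false
            Y≁walk y∈Y m lt = ¬-not (λ h → Y-unattached _ (y∈Y , m , lt , h))
            c∉path : ∀ m → m ≤ suc k → c ≢ w m
            c∉path = bracket-avoids a a′ p k c c≢a c≢a′ (X∉walk c∈X)
            c≁walk : ∀ m → m < k → H c (p m) ≡ false
            c≁walk m lt = ¬-not (λ h → case attached-split (c∈X , m , lt , h) of λ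
              { (inj₁ early) → clean-X-init (c , a , c≢a , early , (a∈X , 0 , s≤s z≤n , a~first))
              ; (inj₂ late)  → clean-X-tail (c , a′ , c≢a′ , late , (a′∈X , L′ , ≤-refl , a′~last)) })

        contradiction : ⊥
        contradiction with hasChord? p k
        ... | yes (j , j<k , i , i<j , inj₁ pi≡pj) = repeat-case i j i<j j<k pi≡pj
        ... | yes (j , j<k , i , _ , inj₂ (si<j , chord)) = chord-case i j si<j j<k chord
        ... | no no-chord with any? (λ y → attached? Y p k y)
        ...   | yes (b , b-att) = Chordless.attached-Y-case no-chord b b-att
        ...   | no none = Chordless.unattached-Y-case no-chord (λ y y-att → none (y , y-att))

      minimal-walk-contradiction : DoublyAttached X p k → ⊥
      minimal-walk-contradiction doubly = WithEnds.contradiction (ends doubly)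

  -- Either a shorter sub-walk is already
  -- doubly attached, or the walk is minimal and MinimalWalk applies (to the
  -- frame as given or with its sides swapped).
  attachment-bounded : ∀ {X Y} (F : Frame G X Y) → NoExtension X Y → NoExtension Y X →
    ∀ bound k → k < bound → ∀ p → OutsideWalk p k X Y → 0 < k →
    DoublyAttached X p k ⊎ DoublyAttached Y p k → ⊥
  attachment-bounded F no-ext-X no-ext-Y zero k () p walk pos doubly
  attachment-bounded F no-ext-X no-ext-Y (suc b) zero _ p walk () _
  attachment-bounded F no-ext-X no-ext-Y (suc b) (suc zero) _ p walk _
    (inj₁ (x , x′ , x≢x′ , (x∈ , zero , _ , x~) , (x′∈ , zero , _ , x′~))) =
    OnFrame.one-vertex-case F no-ext-X (p 0) x x′
      (OutsideWalk.avoids-X walk 0 (s≤s z≤n)) (OutsideWalk.avoids-Y walk 0 (s≤s z≤n)) x∈ x′∈ x≢x′ x~ x′~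
  attachment-bounded F no-ext-X no-ext-Y (suc b) (suc zero) _ p walk _
    (inj₂ (y , y′ , y≢y′ , (y∈ , zero , _ , y~) , (y′∈ , zero , _ , y′~))) =
    OnFrame.one-vertex-case (swap-frame F) no-ext-Y (p 0) y y′
      (OutsideWalk.avoids-Y walk 0 (s≤s z≤n)) (OutsideWalk.avoids-X walk 0 (s≤s z≤n)) y∈ y′∈ y≢y′ y~ y′~
  attachment-bounded F _ _ (suc b) (suc zero) _ p walk _ (inj₁ (_ , _ , _ , (_ , suc _ , s≤s () , _) , _))
  attachment-bounded F _ _ (suc b) (suc zero) _ p walk _ (inj₁ (_ , _ , _ , _ , (_ , suc _ , s≤s () , _)))
  attachment-bounded F _ _ (suc b) (suc zero) _ p walk _ (inj₂ (_ , _ , _ , (_ , suc _ , s≤s () , _) , _))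
  attachment-bounded F _ _ (suc b) (suc zero) _ p walk _ (inj₂ (_ , _ , _ , _ , (_ , suc _ , s≤s () , _)))
  attachment-bounded {X} {Y} F no-ext-X no-ext-Y (suc b) (suc (suc L′)) k<b p walk _ doubly
    with doublyAttached? X p (suc L′) | doublyAttached? Y p (suc L′)
       | doublyAttached? X (p ∘ suc) (suc L′) | doublyAttached? Y (p ∘ suc) (suc L′)
  ... | yes dX | _ | _ | _ = shorter p (walk-init walk) (s≤s z≤n) (inj₁ dX)
    where shorter = attachment-bounded F no-ext-X no-ext-Y b (suc L′) (≤-pred k<b)
  ... | no _ | yes dY | _ | _ = shorter p (walk-init walk) (s≤s z≤n) (inj₂ dY)
    where shorter = attachment-bounded F no-ext-X no-ext-Y b (suc L′) (≤-pred k<b)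
  ... | no _ | no _ | yes dX | _ = shorter (p ∘ suc) (walk-tail walk) (s≤s z≤n) (inj₁ dX)
    where shorter = attachment-bounded F no-ext-X no-ext-Y b (suc L′) (≤-pred k<b)
  ... | no _ | no _ | no _ | yes dY = shorter (p ∘ suc) (walk-tail walk) (s≤s z≤n) (inj₂ dY)
    where shorter = attachment-bounded F no-ext-X no-ext-Y b (suc L′) (≤-pred k<b)
  ... | no ¬X-init | no ¬Y-init | no ¬X-tail | no ¬Y-tail with doubly
  ...   | inj₁ dX = OnFrame.MinimalWalk.minimal-walk-contradiction F L′ p walk ¬X-init ¬X-tail ¬Y-init ¬Y-tail
                      (λ k′ lt q walk′ pos d → attachment-bounded F no-ext-X no-ext-Y b k′ (<-≤-trans lt (≤-pred k<b)) q walk′ pos (inj₁ d))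
                      dX
  ...   | inj₂ dY = OnFrame.MinimalWalk.minimal-walk-contradiction (swap-frame F) L′ p (swap-walk walk)
                      ¬Y-init ¬Y-tail ¬X-init ¬X-tail
                      (λ k′ lt q walk′ pos d → attachment-bounded F no-ext-X no-ext-Y b k′ (<-≤-trans lt (≤-pred k<b)) q (swap-walk walk′) pos (inj₂ d))
                      dY

  attachment-lemma : ∀ {X Y} (F : Frame G X Y) → NoExtension X Y → NoExtension Y X →
    ∀ p k → OutsideWalk p k X Y → 0 < k → DoublyAttached X p k ⊎ DoublyAttached Y p k → ⊥
  attachment-lemma F no-ext-X no-ext-Y p k = attachment-bounded F no-ext-X no-ext-Y (suc k) k ≤-refl p

three-elements : ∀ {n} {p : Subset n} {x y z} → x ∈ p → y ∈ p → z ∈ p → x ≢ y → x ≢ z → y ≢ z → 3 ≤ ∣ p ∣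
three-elements {p = p} {x} {y} {z} x∈ y∈ z∈ x≢y x≢z y≢z =
  ≤-trans (s≤s (≤-trans (s≤s (≤-trans (s≤s z≤n) (x∈p⇒∣p-x∣<∣p∣ z∈p-x-y))) (x∈p⇒∣p-x∣<∣p∣ y∈p-x)))
          (x∈p⇒∣p-x∣<∣p∣ x∈)
  where
  y∈p-x : y ∈ p - x
  y∈p-x = x∈p∧x≢y⇒x∈p-y y∈ (λ e → x≢y (sym e))
  z∈p-x-y : z ∈ p - x - y
  z∈p-x-y = x∈p∧x≢y⇒x∈p-y (x∈p∧x≢y⇒x∈p-y z∈ (λ e → x≢z (sym e))) (λ e → y≢z (sym e))

accepted : ∀ {P : Set} (P? : Dec P) → does P? ≡ true → P
accepted (yes p) _ = p

strong-if-not-semi : ∀ {a} → a ≢ anti → a ≢ semi → a ≡ strong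
strong-if-not-semi {strong} _ _ = refl
strong-if-not-semi {semi}   _ a≢semi = ⊥-elim (a≢semi refl)
strong-if-not-semi {anti}   a≢anti _ = ⊥-elim (a≢anti refl)

module Growth {n : ℕ} (G : Trigraph n) (free : ISK4WheelFree G) where
  open Reachability G

  full : Realization G
  full = fullRealization G

  module Full = InRealization G full (proj₁ (free full)) (proj₂ (free full))

  Extends : Subset n → Subset n → Fin n → Set
  Extends X Y v = v ∉ X × v ∉ Y × (∀ x → x ∈ X → θ G v x ≢ anti) × (∀ y → y ∈ Y → θ G v y ≡ anti)

  extends? : ∀ X Y v → Dec (Extends X Y v)
  extends? X Y v = ¬? (v ∈? X) ×-dec ¬? (v ∈? Y) ×-dec
    all? (λ x → (x ∈? X) →-dec ¬? (θ G v x ≟-adj anti)) ×-dec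
    all? (λ y → (y ∈? Y) →-dec (θ G v y ≟-adj anti))

  -- An extending vertex is not semi-adjacent to any x₀ ∈ X: in the
  -- realization where v x₀ is a non-edge, v would see two vertices of X, miss
  -- x₀ and miss Y, which gives an ISK4.
  extension-not-semi : ∀ {X Y} → Frame G X Y → ∀ v x₀ → Extends X Y v → x₀ ∈ X → θ G v x₀ ≡ semi → ⊥
  extension-not-semi {X} {Y} F v x₀ (v∉X , v∉Y , v~X , v-anti-Y) x₀∈X semi-pair = two-others
    where
    open Frame F
    R = toggledRealization G v x₀ semi-pair
    module T = InRealization G R (proj₁ (free R)) (proj₂ (free R))
    v≢x₀ : v ≢ x₀
    v≢x₀ e = v∉X (subst (_∈ X) (sym e) x₀∈X)
    v~others : ∀ x → x ∈ X → x ≢ x₀ → T.H v x ≡ true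
    v~others x x∈X x≢x₀ rewrite isPair-other {u = v} {x₀} v x (λ { (_ , e) → x≢x₀ e }) (λ { (e , _) → v≢x₀ e }) =
      trans (∧-identityʳ _) (fullEdge-adjacent (v~X x x∈X))
    v≁x₀ : T.H v x₀ ≡ false
    v≁x₀ rewrite isPair-uv v x₀ = ∧-zeroʳ _
    v≁Y : ∀ y → y ∈ Y → T.H v y ≡ false
    v≁Y y y∈Y rewrite v-anti-Y y y∈Y = refl
    isk4 : ∀ x x′ → x ∈ X → x′ ∈ X → x ≢ x′ → x ≢ x₀ → x′ ≢ x₀ → ⊥
    isk4 x x′ x∈X x′∈X x≢x′ x≢x₀ x′≢x₀ =
      T.OnFrame.sees-two-misses-one-of-X F v x x′ x₀ v∉X v∉Y x∈X x′∈X x₀∈X x≢x′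
        (v~others x x∈X x≢x₀) (v~others x′ x′∈X x′≢x₀) v≁x₀ v≁Y
    two-others : ⊥
    two-others with x₁ ≟ x₀ | x₂ ≟ x₀
    ... | yes refl | _ = isk4 x₂ x₃ x₂∈ x₃∈ x₂≢x₃ (λ e → x₁≢x₂ (sym e)) (λ e → x₁≢x₃ (sym e))
    ... | no x₁≢x₀ | yes refl = isk4 x₁ x₃ x₁∈ x₃∈ x₁≢x₃ x₁≢x₀ (λ e → x₂≢x₃ (sym e))
    ... | no x₁≢x₀ | no x₂≢x₀ = isk4 x₁ x₂ x₁∈ x₂∈ x₁≢x₂ x₁≢x₀ x₂≢x₀

  add-to-Y : ∀ {X Y} → Frame G X Y → ∀ v → v ∉ X → v ∉ Y →
    (∀ x → x ∈ X → θ G v x ≡ strong) → (∀ y → y ∈ Y → θ G v y ≡ anti) → Frame G X (Y ∪ ⁅ v ⁆)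
  add-to-Y {X} {Y} F v v∉X v∉Y v-X v-Y = record
    { X-stable = X-stable ; Y-stable = Y′-stable ; complete = complete′ ; disjoint = disjoint′
    ; x₁ = x₁ ; x₂ = x₂ ; x₃ = x₃ ; y₁ = y₁ ; y₂ = y₂ ; y₃ = y₃
    ; x₁∈ = x₁∈ ; x₂∈ = x₂∈ ; x₃∈ = x₃∈ ; y₁∈ = old y₁∈ ; y₂∈ = old y₂∈ ; y₃∈ = old y₃∈
    ; x₁≢x₂ = x₁≢x₂ ; x₁≢x₃ = x₁≢x₃ ; x₂≢x₃ = x₂≢x₃ ; y₁≢y₂ = y₁≢y₂ ; y₁≢y₃ = y₁≢y₃ ; y₂≢y₃ = y₂≢y₃ }
    where
    open Frame F
    old : ∀ {u} → u ∈ Y → u ∈ Y ∪ ⁅ v ⁆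
    old = p⊆p∪q ⁅ v ⁆
    Y′-stable : StronglyStable G (Y ∪ ⁅ v ⁆)
    Y′-stable u w u∈ w∈ u≢w with x∈p∪q⁻ Y ⁅ v ⁆ u∈ | x∈p∪q⁻ Y ⁅ v ⁆ w∈
    ... | inj₁ u∈Y | inj₁ w∈Y = Y-stable u w u∈Y w∈Y u≢w
    ... | inj₁ u∈Y | inj₂ w≡v rewrite x∈⁅y⁆⇒x≡y v w≡v = trans (θ-sym G u v) (v-Y u u∈Y)
    ... | inj₂ u≡v | inj₁ w∈Y rewrite x∈⁅y⁆⇒x≡y v u≡v = v-Y w w∈Y
    ... | inj₂ u≡v | inj₂ w≡v = ⊥-elim (u≢w (trans (x∈⁅y⁆⇒x≡y v u≡v) (sym (x∈⁅y⁆⇒x≡y v w≡v))))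
    complete′ : ∀ u w → u ∈ X → w ∈ Y ∪ ⁅ v ⁆ → θ G u w ≡ strong
    complete′ u w u∈X w∈ with x∈p∪q⁻ Y ⁅ v ⁆ w∈
    ... | inj₁ w∈Y = complete u w u∈X w∈Y
    ... | inj₂ w≡v rewrite x∈⁅y⁆⇒x≡y v w≡v = trans (θ-sym G u v) (v-X u u∈X)
    disjoint′ : ∀ u → u ∈ X → u ∉ Y ∪ ⁅ v ⁆
    disjoint′ u u∈X u∈ with x∈p∪q⁻ Y ⁅ v ⁆ u∈
    ... | inj₁ u∈Y = disjoint u u∈X u∈Y
    ... | inj₂ u≡v = v∉X (subst (_∈ X) (x∈⁅y⁆⇒x≡y v u≡v) u∈X)

  covering-frame-thick : ∀ {X Y} → Frame G X Y → (∀ v → ¬ (v ∉ X × v ∉ Y)) → IsThickCompleteBipartite G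
  covering-frame-thick {X} {Y} F covers =
    X , X-stable , ∁X-stable , (λ u v u∈X v∉X → complete u v u∈X (in-Y v v∉X)) ,
    three-elements x₁∈ x₂∈ x₃∈ x₁≢x₂ x₁≢x₃ x₂≢x₃ ,
    three-elements (∉X y₁∈) (∉X y₂∈) (∉X y₃∈) y₁≢y₂ y₁≢y₃ y₂≢y₃
    where
    open Frame F
    in-Y : ∀ u → u ∉ X → u ∈ Y
    in-Y u u∉X with u ∈? Y
    ... | yes u∈Y = u∈Y
    ... | no u∉Y = ⊥-elim (covers u (u∉X , u∉Y))
    ∉X : ∀ {y} → y ∈ Y → y ∈ ∁ X
    ∉X {y} y∈Y = x∉p⇒x∈∁p (λ y∈X → disjoint y y∈X y∈Y)
    ∁X-stable : StronglyStable G (∁ X)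
    ∁X-stable u v u∈ v∈ = Y-stable u v (in-Y u (x∈∁p⇒x∉p u∈)) (in-Y v (x∈∁p⇒x∉p v∈))

  -- A frame that cannot be extended but misses a vertex v₀ yields a clique
  -- cutset: the vertices of X ∪ Y with a neighbour in the component of v₀ in
  -- G \ (X ∪ Y).  By the attachment lemma it has at most one vertex on each
  -- side, so it is a clique, and it separates v₀ from x₁ or x₂.
  module CliqueCut {X Y : Subset n} (F : Frame G X Y) (v₀ : Fin n) (v₀∉X : v₀ ∉ X) (v₀∉Y : v₀ ∉ Y)
                   (no-ext-Y : ∀ v → ¬ Extends X Y v) (no-ext-X : ∀ v → ¬ Extends Y X v) where
    open Frame F

    S = X ∪ Y
    outside = ∁ S

    -- In the full realization, "adjacent" is "edge", so NoExtension holds.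
    no-extension : ∀ {X′ Y′} → (∀ v → ¬ Extends X′ Y′ v) → Full.NoExtension X′ Y′
    no-extension no-ext v v∉X′ v∉Y′ v~X′ v≁Y′ =
      no-ext v (v∉X′ , v∉Y′ , (λ x x∈ → fullEdge-true (v~X′ x x∈)) , (λ y y∈ → fullEdge-false (v≁Y′ y y∈)))

    Touches : Fin n → Set
    Touches x = x ∈ S × Σ (Fin n) λ w → Reach G outside v₀ w × Adjacent G x w

    touches? : ∀ x → Dec (Touches x)
    touches? x = (x ∈? S) ×-dec any? (λ w → reach? outside v₀ w ×-dec adjacent? x w)

    C : Subset n
    C = tabulate (λ x → does (touches? x))

    ∈C : ∀ {x} → Touches x → x ∈ C
    ∈C {x} t = lookup⇒[]= x C (trans (lookup∘tabulate (λ z → does (touches? z)) x) (dec-true (touches? x) t))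

    ∈C⁻ : ∀ {x} → x ∈ C → Touches x
    ∈C⁻ {x} x∈C = accepted (touches? x) (trans (sym (lookup∘tabulate (λ z → does (touches? z)) x)) ([]=⇒lookup x∈C))

    off-frame : ∀ {u} → u ∈ outside → u ∉ X × u ∉ Y
    off-frame u∉S = (λ u∈X → x∈∁p⇒x∉p u∉S (p⊆p∪q Y u∈X)) , (λ u∈Y → x∈∁p⇒x∉p u∉S (q⊆p∪q X Y u∈Y))

    -- Two distinct vertices of C on the same side would be doubly attached
    -- to a walk through the component of v₀.
    same-side : ∀ {x y} → x ≢ y → Touches x → Touches y → (x ∈ X × y ∈ X) ⊎ (x ∈ Y × y ∈ Y) → ⊥
    same-side {x} {y} x≢y (_ , w₁ , r₁ , x~w₁) (_ , w₂ , r₂ , y~w₂) side with reach→walk (reach-trans (reach-sym r₁) r₂)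
    ... | k , p , p₀ , pk , inside , steps =
      Full.attachment-lemma F (no-extension no-ext-Y) (no-extension no-ext-X) p (suc k) walk (s≤s z≤n) doubly
      where
      walk : Full.OutsideWalk p (suc k) X Y
      walk = record { avoids-X = λ m lt → proj₁ (off-frame (inside m lt))
                    ; avoids-Y = λ m lt → proj₂ (off-frame (inside m lt))
                    ; steps    = λ m lt → fullEdge-adjacent (steps m lt) }
      x~first : Full.H x (p 0) ≡ true
      x~first = fullEdge-adjacent (subst (Adjacent G x) (sym p₀) x~w₁)
      y~last : Full.H y (p k) ≡ true
      y~last = fullEdge-adjacent (subst (Adjacent G y) (sym pk) y~w₂)
      doubly : Full.DoublyAttached X p (suc k) ⊎ Full.DoublyAttached Y p (suc k)
      doubly = case side of λ
        { (inj₁ (x∈X , y∈X)) → inj₁ (x , y , x≢y , (x∈X , 0 , s≤s z≤n , x~first) , (y∈X , k , ≤-refl , y~last))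
        ; (inj₂ (x∈Y , y∈Y)) → inj₂ (x , y , x≢y , (x∈Y , 0 , s≤s z≤n , x~first) , (y∈Y , k , ≤-refl , y~last)) }

    clique : ∀ u w → u ∈ C → w ∈ C → u ≢ w → θ G u w ≡ strong
    clique u w u∈C w∈C u≢w with x∈p∪q⁻ X Y (proj₁ (∈C⁻ u∈C)) | x∈p∪q⁻ X Y (proj₁ (∈C⁻ w∈C))
    ... | inj₁ u∈X | inj₁ w∈X = ⊥-elim (same-side u≢w (∈C⁻ u∈C) (∈C⁻ w∈C) (inj₁ (u∈X , w∈X)))
    ... | inj₁ u∈X | inj₂ w∈Y = complete u w u∈X w∈Y
    ... | inj₂ u∈Y | inj₁ w∈X = trans (θ-sym G u w) (complete w u w∈X u∈Y)
    ... | inj₂ u∈Y | inj₂ w∈Y = ⊥-elim (same-side u≢w (∈C⁻ u∈C) (∈C⁻ w∈C) (inj₂ (u∈Y , w∈Y)))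

    v₀-outside : v₀ ∈ outside
    v₀-outside = x∉p⇒x∈∁p (λ v₀∈S → case x∈p∪q⁻ X Y v₀∈S of λ { (inj₁ v₀∈X) → v₀∉X v₀∈X ; (inj₂ v₀∈Y) → v₀∉Y v₀∈Y })

    v₀∉C : v₀ ∉ C
    v₀∉C v₀∈C = x∈∁p⇒x∉p v₀-outside (proj₁ (∈C⁻ v₀∈C))

    -- A path in G \ C from the component of v₀ cannot reach X ∪ Y: the first
    -- vertex of X ∪ Y on it would touch the component, hence lie in C.
    trapped : ∀ {u t} → Reach G outside v₀ u → Reach G (∁ C) u t → t ∈ S → ⊥
    trapped r₀ (here _) t∈S = x∈∁p⇒x∉p (reach-end r₀) t∈S
    trapped {u} r₀ (step {w = u₂} _ u~u₂ r) t∈S with u₂ ∈? S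
    ... | yes u₂∈S = x∈∁p⇒x∉p (reach-start r) (∈C (u₂∈S , u , r₀ , adjacent-sym u~u₂))
    ... | no u₂∉S = trapped (reach-snoc r₀ u~u₂ (x∉p⇒x∈∁p u₂∉S)) r t∈S

    -- x₁ and x₂ are not both in C, and the one outside C is not reachable
    -- from v₀ in G \ C.
    cutset : IsCutset G C
    cutset connected with x₁ ∈? C | x₂ ∈? C
    ... | yes x₁∈C | yes x₂∈C = same-side x₁≢x₂ (∈C⁻ x₁∈C) (∈C⁻ x₂∈C) (inj₁ (x₁∈ , x₂∈))
    ... | no x₁∉C | _ = trapped (here v₀-outside) (connected v₀ x₁ (x∉p⇒x∈∁p v₀∉C) (x∉p⇒x∈∁p x₁∉C)) (p⊆p∪q Y x₁∈)
    ... | yes _ | no x₂∉C = trapped (here v₀-outside) (connected v₀ x₂ (x∉p⇒x∈∁p v₀∉C) (x∉p⇒x∈∁p x₂∉C)) (p⊆p∪q Y x₂∈)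

    clique-cutset : HasCliqueCutset G
    clique-cutset = C , cutset , clique

  -- An extending vertex is strongly complete to X (it is not semi-adjacent
  -- to X), so it joins Y.
  extend-frame : ∀ {X Y} → Frame G X Y → ∀ v → Extends X Y v → Frame G X (Y ∪ ⁅ v ⁆)
  extend-frame F v ext@(v∉X , v∉Y , v~X , v-Y) =
    add-to-Y F v v∉X v∉Y (λ x x∈X → strong-if-not-semi (v~X x x∈X) (extension-not-semi F v x ext x∈X)) v-Y

  union-grows-right : ∀ {X Y : Subset n} v → v ∉ X → v ∉ Y → ∣ X ∪ Y ∣ < ∣ X ∪ (Y ∪ ⁅ v ⁆) ∣
  union-grows-right {X} {Y} v v∉X v∉Y = p⊂q⇒∣p∣<∣q∣ (old , v , new , fresh)
    where
    old : ∀ {x} → x ∈ X ∪ Y → x ∈ X ∪ (Y ∪ ⁅ v ⁆)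
    old x∈ = case x∈p∪q⁻ X Y x∈ of λ
      { (inj₁ x∈X) → x∈p∪q⁺ (inj₁ x∈X) ; (inj₂ x∈Y) → x∈p∪q⁺ (inj₂ (x∈p∪q⁺ (inj₁ x∈Y))) }
    new : v ∈ X ∪ (Y ∪ ⁅ v ⁆)
    new = x∈p∪q⁺ (inj₂ (x∈p∪q⁺ (inj₂ (x∈⁅x⁆ v))))
    fresh : v ∉ X ∪ Y
    fresh v∈ = case x∈p∪q⁻ X Y v∈ of λ { (inj₁ v∈X) → v∉X v∈X ; (inj₂ v∈Y) → v∉Y v∈Y }

  union-grows-left : ∀ {X Y : Subset n} v → v ∉ X → v ∉ Y → ∣ X ∪ Y ∣ < ∣ (X ∪ ⁅ v ⁆) ∪ Y ∣
  union-grows-left {X} {Y} v v∉X v∉Y = p⊂q⇒∣p∣<∣q∣ (old , v , new , fresh)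
    where
    old : ∀ {x} → x ∈ X ∪ Y → x ∈ (X ∪ ⁅ v ⁆) ∪ Y
    old x∈ = case x∈p∪q⁻ X Y x∈ of λ
      { (inj₁ x∈X) → x∈p∪q⁺ (inj₁ (x∈p∪q⁺ (inj₁ x∈X))) ; (inj₂ x∈Y) → x∈p∪q⁺ (inj₂ x∈Y) }
    new : v ∈ (X ∪ ⁅ v ⁆) ∪ Y
    new = x∈p∪q⁺ (inj₁ (x∈p∪q⁺ (inj₂ (x∈⁅x⁆ v))))
    fresh : v ∉ X ∪ Y
    fresh v∈ = case x∈p∪q⁻ X Y v∈ of λ { (inj₁ v∈X) → v∉X v∈X ; (inj₂ v∈Y) → v∉Y v∈Y }

  Outcome : Set
  Outcome = IsThickCompleteBipartite G ⊎ HasCliqueCutset G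

  grow-step : ∀ {X Y} → Frame G X Y →
    (∀ {X′ Y′} → Frame G X′ Y′ → ∣ X ∪ Y ∣ < ∣ X′ ∪ Y′ ∣ → Outcome) → Outcome
  grow-step {X} {Y} F larger with any? (λ v → ¬? (v ∈? X) ×-dec ¬? (v ∈? Y))
  ... | no covers = inj₁ (covering-frame-thick F (λ v off → covers (v , off)))
  ... | yes (v₀ , v₀∉X , v₀∉Y) with any? (extends? X Y) | any? (extends? Y X)
  ...   | yes (v , ext@(v∉X , v∉Y , _)) | _ =
    larger (extend-frame F v ext) (union-grows-right v v∉X v∉Y)
  ...   | no _ | yes (v , ext@(v∉Y , v∉X , _)) =
    larger (swap-frame (extend-frame (swap-frame F) v ext)) (union-grows-left v v∉X v∉Y)
  ...   | no no-ext-Y | no no-ext-X =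
    inj₂ (CliqueCut.clique-cutset F v₀ v₀∉X v₀∉Y (λ v e → no-ext-Y (v , e)) (λ v e → no-ext-X (v , e)))

  -- Iterating growth steps; the frame can grow at most n times.
  grow : ∀ fuel {X Y} → Frame G X Y → n ≤ ∣ X ∪ Y ∣ + fuel → Outcome
  grow zero {X} {Y} F n≤ = grow-step F (λ {X′} {Y′} _ lt →
    ⊥-elim (<-irrefl refl (≤-trans lt (≤-trans (∣p∣≤n (X′ ∪ Y′)) (subst (n ≤_) (+-identityʳ _) n≤)))))
  grow (suc fuel) {X} {Y} F n≤ = grow-step F (λ {X′} {Y′} F′ lt →
    grow fuel F′ (≤-trans n≤ (subst (_≤ ∣ X′ ∪ Y′ ∣ + fuel) (sym (+-suc (∣ X ∪ Y ∣) fuel)) (+-monoˡ-≤ fuel lt))))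

image3 : ∀ {n} → (Fin 3 → Fin n) → Subset n
image3 f = ⁅ f zero ⁆ ∪ (⁅ f (suc zero) ⁆ ∪ ⁅ f (suc (suc zero)) ⁆)

image3⁻ : ∀ {n} (f : Fin 3 → Fin n) {u} → u ∈ image3 f → Σ (Fin 3) λ i → u ≡ f i
image3⁻ f u∈ with x∈p∪q⁻ ⁅ f zero ⁆ _ u∈
... | inj₁ u∈₀ = zero , x∈⁅y⁆⇒x≡y _ u∈₀
... | inj₂ u∈₁₂ with x∈p∪q⁻ ⁅ f (suc zero) ⁆ _ u∈₁₂
...   | inj₁ u∈₁ = suc zero , x∈⁅y⁆⇒x≡y _ u∈₁
...   | inj₂ u∈₂ = suc (suc zero) , x∈⁅y⁆⇒x≡y _ u∈₂

image3-stable : ∀ {n} {G : Trigraph n} (f : Fin 3 → Fin n) →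
  (∀ i j → i ≢ j → θ G (f i) (f j) ≡ anti) → StronglyStable G (image3 f)
image3-stable f f-anti u v u∈ v∈ u≢v with image3⁻ f u∈ | image3⁻ f v∈
... | i , refl | j , refl = f-anti i j (λ i≡j → u≢v (cong f i≡j))

k33-frame : ∀ {n} (G : Trigraph n) → ContainsStrongK33 G → Σ (Subset n) λ X → Σ (Subset n) λ Y → Frame G X Y
k33-frame {n} G (a , b , a-inj , b-inj , a≢b , a-b , a-anti , b-anti) = image3 a , image3 b , record
  { X-stable = image3-stable {G = G} a a-anti ; Y-stable = image3-stable {G = G} b b-anti
  ; complete = complete ; disjoint = disjoint
  ; x₁ = a zero ; x₂ = a (suc zero) ; x₃ = a (suc (suc zero))
  ; y₁ = b zero ; y₂ = b (suc zero) ; y₃ = b (suc (suc zero))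
  ; x₁∈ = first a ; x₂∈ = second a ; x₃∈ = third a ; y₁∈ = first b ; y₂∈ = second b ; y₃∈ = third b
  ; x₁≢x₂ = λ e → case a-inj e of λ () ; x₁≢x₃ = λ e → case a-inj e of λ () ; x₂≢x₃ = λ e → case a-inj e of λ ()
  ; y₁≢y₂ = λ e → case b-inj e of λ () ; y₁≢y₃ = λ e → case b-inj e of λ () ; y₂≢y₃ = λ e → case b-inj e of λ () }
  where
  first  : ∀ (f : Fin 3 → Fin n) → f zero ∈ image3 f
  second : ∀ (f : Fin 3 → Fin n) → f (suc zero) ∈ image3 f
  third  : ∀ (f : Fin 3 → Fin n) → f (suc (suc zero)) ∈ image3 f
  first  f = x∈p∪q⁺ (inj₁ (x∈⁅x⁆ (f zero)))
  second f = x∈p∪q⁺ (inj₂ (x∈p∪q⁺ (inj₁ (x∈⁅x⁆ (f (suc zero))))))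
  third  f = x∈p∪q⁺ (inj₂ (x∈p∪q⁺ (inj₂ (x∈⁅x⁆ (f (suc (suc zero)))))))
  complete : ∀ u v → u ∈ image3 a → v ∈ image3 b → θ G u v ≡ strong
  complete u v u∈ v∈ with image3⁻ a u∈ | image3⁻ b v∈
  ... | i , refl | j , refl = a-b i j
  disjoint : ∀ u → u ∈ image3 a → u ∉ image3 b
  disjoint u u∈ u∈′ with image3⁻ a u∈ | image3⁻ b u∈′
  ... | i , u≡ai | j , u≡bj = a≢b i j (trans (sym u≡ai) u≡bj)

lemma4p18 : ∀ {n : ℕ} (G : Trigraph n) → ISK4WheelFree G → ContainsStrongK33 G →
    IsThickCompleteBipartite G ⊎ HasCliqueCutset G
lemma4p18 {n} G free k33 with k33-frame G k33
... | X , Y , F = Growth.grow G free n F (m≤n+m n ∣ X ∪ Y ∣)
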